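{- The family of finite distributive vi-lattices is 2-summable.
   Context: A vi-lattice is a lattice that is not a vertical sum (top of one identified with the bottom of the other) of two non-singleton lattices. Vertical 2-sum: for disjoint finite lattices $L,U$ of length at least 3, $L$ with exactly two coatoms $c_1,c_2$ and $U$ with exactly two atoms $a_1,a_2$, the two vertical 2-sums are obtained by removing the top of $L$ and the bottom of $U$ and identifying $(c_1,c_2)$ with $(a_1,a_2)$ or with $(a_2,a_1)$. A family $\mathcal{F}$ of graded vi-lattices is 2-summable if (C1) whenever $L,U\in\mathcal{F}$ and $S$ is one of their vertical 2-sums, $S\in\mathcal{F}$; and (C2) whenever $S\in\mathcal{F}$ is a vertical 2-sum of $L$ and $U$, then $L,U\in\mathcal{F}$. -}

module Defs where

open import Data.Nat using (ℕ)
open import Data.Fin using (Fin)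
open import Data.Product using (Σ; ∃; ∃₂; _×_; _,_)
open import Data.Sum using (_⊎_; inj₁; inj₂)
open import Data.Empty using (⊥)
open import Data.Unit using (⊤)
open import Relation.Nullary using (¬_)
open import Relation.Nullary.Decidable using (False)
open import Relation.Binary.PropositionalEquality using (_≡_; _≢_)
open import Relation.Binary.Definitions using (DecidableEquality)
open import Relation.Binary.Structures using (IsPartialOrder)
open import Function.Bundles using (_↔_; Inverse; _⇔_)

-- A carrier with a binary relation (the order). All order-theoretic
-- laws are imposed as predicates below, not as fields.
record Ord : Set₁ where
  field
    Carrier : Set
    _≤_     : Carrier → Carrier → Set

open Ord public

module _ (P : Ord) where
  private
    C = Carrier P
    _≤′_ = _≤_ P

  Lt : C → C → Set
  Lt x y = x ≤′ y × x ≢ y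

  IsFinite : Set
  IsFinite = ∃ λ n → C ↔ Fin n

  IsPoset : Set
  IsPoset = IsPartialOrder _≡_ _≤′_

  IsLUB : C → C → C → Set
  IsLUB x y s = x ≤′ s × y ≤′ s × (∀ z → x ≤′ z → y ≤′ z → s ≤′ z)

  IsGLB : C → C → C → Set
  IsGLB x y m = m ≤′ x × m ≤′ y × (∀ z → z ≤′ x → z ≤′ y → z ≤′ m)

  -- a (nonempty) lattice, defined order-theoretically
  IsLattice : Set
  IsLattice = C × IsPoset
            × (∀ x y → ∃ (IsLUB x y)) × (∀ x y → ∃ (IsGLB x y))

  -- x ∧ (y ∨ z) = (x ∧ y) ∨ (x ∧ z), expressed with glb/lub predicates
  IsDistributive : Set
  IsDistributive = ∀ x y z a b c d e →
    IsLUB y z a → IsGLB x a b → IsGLB x y c → IsGLB x z d → IsLUB c d e → b ≡ e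

  IsTop : C → Set
  IsTop t = ∀ x → x ≤′ t

  IsBot : C → Set
  IsBot b = ∀ x → b ≤′ x

  -- c is covered by t (coatom when t is the top)
  IsCoatom : C → C → Set
  IsCoatom t c = Lt c t × (∀ z → Lt c z → Lt z t → ⊥)

  -- a covers b (atom when b is the bottom)
  IsAtom : C → C → Set
  IsAtom b a = Lt b a × (∀ z → Lt b z → Lt z a → ⊥)

  ExactlyTwoCoatoms : C → C → C → Set
  ExactlyTwoCoatoms t c₁ c₂ = IsCoatom t c₁ × IsCoatom t c₂ × c₁ ≢ c₂
    × (∀ c → IsCoatom t c → c ≡ c₁ ⊎ c ≡ c₂)

  ExactlyTwoAtoms : C → C → C → Set
  ExactlyTwoAtoms b a₁ a₂ = IsAtom b a₁ × IsAtom b a₂ × a₁ ≢ a₂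
    × (∀ a → IsAtom b a → a ≡ a₁ ⊎ a ≡ a₂)

  LengthAtLeast3 : Set
  LengthAtLeast3 = Σ C λ x₀ → Σ C λ x₁ → Σ C λ x₂ → Σ C λ x₃ →
    Lt x₀ x₁ × Lt x₁ x₂ × Lt x₂ x₃

  NonSingleton : Set
  NonSingleton = ∃₂ λ (x y : C) → x ≢ y

_≅_ : Ord → Ord → Set
P ≅ Q = Σ (Carrier P ↔ Carrier Q) λ φ →
  ∀ x y → (_≤_ P x y ⇔ _≤_ Q (Inverse.to φ x) (Inverse.to φ y))

-- Vertical sum of L and U (top of L identified with bottom b of U):
-- carrier  L ⊎ (U ∖ {b}).
VSum : (L U : Ord) → DecidableEquality (Carrier U) → Carrier U → Ord
VSum L U eqU b = record { Carrier = CS ; _≤_ = le }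
  where
  CU = Σ (Carrier U) λ y → False (eqU y b)
  CS = Carrier L ⊎ CU
  le : CS → CS → Set
  le (inj₁ x) (inj₁ x′) = _≤_ L x x′
  le (inj₂ (y , _)) (inj₂ (y′ , _)) = _≤_ U y y′
  le (inj₁ _) (inj₂ _) = ⊤
  le (inj₂ _) (inj₁ _) = ⊥

IsVerticalSum : Ord → Set₁
IsVerticalSum S = Σ Ord λ L → Σ Ord λ U →
  Σ (DecidableEquality (Carrier U)) λ eqU → Σ (Carrier U) λ b →
  IsLattice L × IsLattice U × NonSingleton L × NonSingleton U × IsBot U b
  × (S ≅ VSum L U eqU b)

IsViLattice : Ord → Set₁
IsViLattice S = IsLattice S × ¬ IsVerticalSum S

-- Vertical 2-sum: remove top t of L and bottom b of U, identify c₁ with a₁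
-- and c₂ with a₂.  Carrier: (L ∖ {t}) ⊎ (U ∖ {b, a₁, a₂}); the coatoms of L
-- represent the identified elements.  (The other 2-sum is obtained by
-- swapping a₁ and a₂.)
V2Sum : (L U : Ord) → DecidableEquality (Carrier L) → DecidableEquality (Carrier U)
  → (t c₁ c₂ : Carrier L) → (b a₁ a₂ : Carrier U) → Ord
V2Sum L U eqL eqU t c₁ c₂ b a₁ a₂ = record { Carrier = CS ; _≤_ = le }
  where
  CL = Σ (Carrier L) λ x → False (eqL x t)
  CU = Σ (Carrier U) λ y → False (eqU y b) × False (eqU y a₁) × False (eqU y a₂)
  CS = CL ⊎ CU
  le : CS → CS → Set
  le (inj₁ (x , _)) (inj₁ (x′ , _)) = _≤_ L x x′
  le (inj₂ (y , _)) (inj₂ (y′ , _)) = _≤_ U y y′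
  le (inj₁ (x , _)) (inj₂ (y , _)) =
    (_≤_ L x c₁ × _≤_ U a₁ y) ⊎ (_≤_ L x c₂ × _≤_ U a₂ y)
  le (inj₂ _) (inj₁ _) = ⊥

FinDistVi : Ord → Set₁
FinDistVi S = IsFinite S × IsDistributive S × IsViLattice S

{-# OPTIONS --safe #-}
-- A cut point of a lattice is an element comparable with every element and strictly between two
-- others; a finite lattice is a vertical sum exactly when it has one.
--
-- The vertical 2-sum V of L and U embeds into L × U by x ↦ (x , up x) and y ↦ (down y , y), where
-- up x ∈ {b, a₁, a₂, a₁ ∨ a₂} records which coatoms of L lie above x, down y ∈ {c₁ ∧ c₂, c₁, c₂, t}
-- records which atoms of U lie below y, and up is left adjoint to down. When L and U are
-- distributive, coatoms are meet-prime and atoms are join-prime, so up and down are lattice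
-- homomorphisms and the image of V is a sublattice of L × U; hence V is a distributive lattice.
-- Conversely L and U embed into V preserving joins and meets, so distributivity passes back to the
-- summands. Cut points of V come from cut points of L or U and vice versa, which transfers the
-- vi property in both directions.
module Submission where

open import Defs
open import Data.Bool.Properties using (T?; T-irrelevant)
open import Data.Empty using (⊥; ⊥-elim)
open import Data.Fin using (Fin)
import Data.Fin as Fin
open import Data.Fin.Properties using (+↔⊎)
open import Data.List using (List; []; _∷_; allFin)
import Data.List as List
open import Data.List.Membership.Propositional using (_∈_)
open import Data.List.Membership.Propositional.Properties using (∈-map⁺; ∈-allFin)
open import Data.List.Relation.Unary.Any using (here; there)
open import Data.Nat using (suc; zero; _+_)
open import Data.Product.Function.Dependent.Propositional using () renaming (cong to Σ-cong)
open import Data.Sum.Function.Propositional using (_⊎-↔_)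
open import Data.Product using (Σ; ∃; _×_; _,_; proj₁; proj₂)
open import Data.Sum using (_⊎_; inj₁; inj₂; [_,_])
import Data.Sum
open import Data.Sum.Properties using (inj₁-injective)
open import Data.Unit using (tt)
open import Function.Base using (_∘_)
open import Function.Bundles using (_↔_; Inverse; _⇔_; mk⇔; mk↔ₛ′; Equivalence)
open import Function.Properties.Inverse using (↔-refl; ↔-sym; ↔-trans)
open import Level using (0ℓ)
open import Relation.Binary.Definitions using (DecidableEquality)
open import Relation.Binary.Lattice.Bundles using (Lattice)
open import Relation.Binary.PropositionalEquality
  using (_≡_; _≢_; refl; sym; trans; cong; cong₂; subst; subst₂; isEquivalence)
open import Relation.Binary.Structures using (IsPartialOrder)
open import Relation.Nullary using (¬_; Dec; yes; no; _⊎-dec_; _×-dec_)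
open import Relation.Nullary.Decidable
  using (map′; True; False; fromWitness; toWitness; fromWitnessFalse; toWitnessFalse; decidable-stable)

-- Bounds, embeddings and products of orders

module _ {P : Ord} (po : IsPoset P) where
  open IsPartialOrder po using (antisym)

  IsLUB-unique : ∀ {x y s s′} → IsLUB P x y s → IsLUB P x y s′ → s ≡ s′
  IsLUB-unique (xs , ys , least) (xs′ , ys′ , least′) = antisym (least _ xs′ ys′) (least′ _ xs ys)

  IsGLB-unique : ∀ {x y s s′} → IsGLB P x y s → IsGLB P x y s′ → s ≡ s′
  IsGLB-unique (sx , sy , greatest) (sx′ , sy′ , greatest′) = antisym (greatest′ _ sx sy) (greatest _ sx′ sy′)

IsLUB-comm : ∀ {P x y s} → IsLUB P x y s → IsLUB P y x s
IsLUB-comm (xs , ys , least) = ys , xs , λ z y≤z x≤z → least z x≤z y≤z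

IsGLB-comm : ∀ {P x y s} → IsGLB P x y s → IsGLB P y x s
IsGLB-comm (sx , sy , greatest) = sy , sx , λ z z≤y z≤x → greatest z z≤x z≤y

Lt-map : ∀ {P Q : Ord} {h : Carrier P → Carrier Q} →
         (∀ {x y} → _≤_ P x y → _≤_ Q (h x) (h y)) → (∀ {x y} → h x ≡ h y → x ≡ y) →
         ∀ {x y} → Lt P x y → Lt Q (h x) (h y)
Lt-map mono injective (x≤y , x≢y) = mono x≤y , λ hx≡hy → x≢y (injective hx≡hy)

record IsOrderEmbedding (P Q : Ord) (h : Carrier P → Carrier Q) : Set where
  field
    ≤⇔ : ∀ {x y} → _≤_ P x y ⇔ _≤_ Q (h x) (h y)

  mono : ∀ {x y} → _≤_ P x y → _≤_ Q (h x) (h y)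
  mono = Equivalence.to ≤⇔

  reflect : ∀ {x y} → _≤_ Q (h x) (h y) → _≤_ P x y
  reflect = Equivalence.from ≤⇔

module _ {P Q : Ord} {h : Carrier P → Carrier Q} (embedding : IsOrderEmbedding P Q h) where
  open IsOrderEmbedding embedding

  IsOrderEmbedding-reflects-lub : ∀ {x y s} → IsLUB Q (h x) (h y) (h s) → IsLUB P x y s
  IsOrderEmbedding-reflects-lub (xs , ys , least) =
    reflect xs , reflect ys , λ z x≤z y≤z → reflect (least _ (mono x≤z) (mono y≤z))

  IsOrderEmbedding-reflects-glb : ∀ {x y s} → IsGLB Q (h x) (h y) (h s) → IsGLB P x y s
  IsOrderEmbedding-reflects-glb (sx , sy , greatest) =
    reflect sx , reflect sy , λ z z≤x z≤y → reflect (greatest _ (mono z≤x) (mono z≤y))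

record IsLatticeEmbedding (P Q : Ord) (h : Carrier P → Carrier Q) : Set where
  field
    injective     : ∀ {x y} → h x ≡ h y → x ≡ y
    preserves-lub : ∀ {x y s} → IsLUB P x y s → IsLUB Q (h x) (h y) (h s)
    preserves-glb : ∀ {x y s} → IsGLB P x y s → IsGLB Q (h x) (h y) (h s)

IsDistributive-embedding : ∀ {P Q h} → IsLatticeEmbedding P Q h → IsDistributive Q → IsDistributive P
IsDistributive-embedding h distributive x y z a b c d e y∨z x∧a x∧y x∧z c∨d =
  injective (distributive _ _ _ _ _ _ _ _ (preserves-lub y∨z) (preserves-glb x∧a)
                                          (preserves-glb x∧y) (preserves-glb x∧z) (preserves-lub c∨d))
  where open IsLatticeEmbedding h

_×ₒ_ : Ord → Ord → Ord
P ×ₒ Q = record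
  { Carrier = Carrier P × Carrier Q
  ; _≤_ = λ (x , y) (x′ , y′) → _≤_ P x x′ × _≤_ Q y y′
  }

module _ {P Q : Ord} where

  ×-isPoset : IsPoset P → IsPoset Q → IsPoset (P ×ₒ Q)
  ×-isPoset poP poQ = record
    { isPreorder = record
      { isEquivalence = isEquivalence
      ; reflexive = λ { refl → P.refl , Q.refl }
      ; trans = λ (x≤y , x′≤y′) (y≤z , y′≤z′) → P.trans x≤y y≤z , Q.trans x′≤y′ y′≤z′
      }
    ; antisym = λ (x≤y , x′≤y′) (y≤x , y′≤x′) → cong₂ _,_ (P.antisym x≤y y≤x) (Q.antisym x′≤y′ y′≤x′)
    }
    where
    module P = IsPartialOrder poP
    module Q = IsPartialOrder poQ

  ×-IsLUB : ∀ {x x′ s y y′ s′} → IsLUB P x x′ s → IsLUB Q y y′ s′ →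
            IsLUB (P ×ₒ Q) (x , y) (x′ , y′) (s , s′)
  ×-IsLUB (xs , x′s , least) (ys , y′s , least′) = (xs , ys) , (x′s , y′s) ,
    λ (z , z′) (x≤z , y≤z′) (x′≤z , y′≤z′) → least z x≤z x′≤z , least′ z′ y≤z′ y′≤z′

  ×-IsGLB : ∀ {x x′ s y y′ s′} → IsGLB P x x′ s → IsGLB Q y y′ s′ →
            IsGLB (P ×ₒ Q) (x , y) (x′ , y′) (s , s′)
  ×-IsGLB (sx , sx′ , greatest) (sy , sy′ , greatest′) = (sx , sy) , (sx′ , sy′) ,
    λ (z , z′) (z≤x , z′≤y) (z≤x′ , z′≤y′) → greatest z z≤x z≤x′ , greatest′ z′ z′≤y z′≤y′

  module _ (poP : IsPoset P) (poQ : IsPoset Q) where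
    private
      module P = IsPartialOrder poP
      module Q = IsPartialOrder poQ

    ×-IsLUB⁻ : ∀ {p q r} → IsLUB (P ×ₒ Q) p q r →
               IsLUB P (proj₁ p) (proj₁ q) (proj₁ r) × IsLUB Q (proj₂ p) (proj₂ q) (proj₂ r)
    ×-IsLUB⁻ ((p₁≤r₁ , p₂≤r₂) , (q₁≤r₁ , q₂≤r₂) , least) =
        (p₁≤r₁ , q₁≤r₁ , λ z p₁≤z q₁≤z → proj₁ (least (z , _) (p₁≤z , p₂≤r₂) (q₁≤z , q₂≤r₂)))
      , (p₂≤r₂ , q₂≤r₂ , λ z p₂≤z q₂≤z → proj₂ (least (_ , z) (p₁≤r₁ , p₂≤z) (q₁≤r₁ , q₂≤z)))

    ×-IsGLB⁻ : ∀ {p q r} → IsGLB (P ×ₒ Q) p q r →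
               IsGLB P (proj₁ p) (proj₁ q) (proj₁ r) × IsGLB Q (proj₂ p) (proj₂ q) (proj₂ r)
    ×-IsGLB⁻ ((r₁≤p₁ , r₂≤p₂) , (r₁≤q₁ , r₂≤q₂) , greatest) =
        (r₁≤p₁ , r₁≤q₁ , λ z z≤p₁ z≤q₁ → proj₁ (greatest (z , _) (z≤p₁ , r₂≤p₂) (z≤q₁ , r₂≤q₂)))
      , (r₂≤p₂ , r₂≤q₂ , λ z z≤p₂ z≤q₂ → proj₂ (greatest (_ , z) (r₁≤p₁ , z≤p₂) (r₁≤q₁ , z≤q₂)))

    ×-distributive : IsDistributive P → IsDistributive Q → IsDistributive (P ×ₒ Q)
    ×-distributive distP distQ x y z a b c d e y∨z x∧a x∧y x∧z c∨d =
      cong₂ _,_ (distP _ _ _ _ _ _ _ _ (proj₁ (×-IsLUB⁻ y∨z)) (proj₁ (×-IsGLB⁻ x∧a))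
                       (proj₁ (×-IsGLB⁻ x∧y)) (proj₁ (×-IsGLB⁻ x∧z)) (proj₁ (×-IsLUB⁻ c∨d)))
                (distQ _ _ _ _ _ _ _ _ (proj₂ (×-IsLUB⁻ y∨z)) (proj₂ (×-IsGLB⁻ x∧a))
                       (proj₂ (×-IsGLB⁻ x∧y)) (proj₂ (×-IsGLB⁻ x∧z)) (proj₂ (×-IsLUB⁻ c∨d)))

module ClosedImage {A B : Ord} (poB : IsPoset B) (π : Carrier A → Carrier B)
  (π-embedding : IsOrderEmbedding A B π) (π-injective : ∀ {p q} → π p ≡ π q → p ≡ q) (p₀ : Carrier A)
  (∨-closed : ∀ p q → ∃ λ r → IsLUB B (π p) (π q) (π r))
  (∧-closed : ∀ p q → ∃ λ r → IsGLB B (π p) (π q) (π r)) where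
  open IsPartialOrder poB using (antisym) renaming (refl to ≤-refl; trans to ≤-trans)
  open IsOrderEmbedding π-embedding

  isPoset : IsPoset A
  isPoset = record
    { isPreorder = record
      { isEquivalence = isEquivalence
      ; reflexive = λ { refl → reflect ≤-refl }
      ; trans = λ p≤q q≤r → reflect (≤-trans (mono p≤q) (mono q≤r))
      }
    ; antisym = λ p≤q q≤p → π-injective (antisym (mono p≤q) (mono q≤p))
    }

  isLattice : IsLattice A
  isLattice = p₀ , isPoset
    , (λ p q → proj₁ (∨-closed p q) , IsOrderEmbedding-reflects-lub π-embedding (proj₂ (∨-closed p q)))
    , (λ p q → proj₁ (∧-closed p q) , IsOrderEmbedding-reflects-glb π-embedding (proj₂ (∧-closed p q)))

  isLatticeEmbedding : IsLatticeEmbedding A B π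
  isLatticeEmbedding = record
    { injective = π-injective
    ; preserves-lub = λ {p} {q} p∨q → subst (IsLUB B (π p) (π q) ∘ π)
        (IsLUB-unique isPoset (IsOrderEmbedding-reflects-lub π-embedding (proj₂ (∨-closed p q))) p∨q)
        (proj₂ (∨-closed p q))
    ; preserves-glb = λ {p} {q} p∧q → subst (IsGLB B (π p) (π q) ∘ π)
        (IsGLB-unique isPoset (IsOrderEmbedding-reflects-glb π-embedding (proj₂ (∧-closed p q))) p∧q)
        (proj₂ (∧-closed p q))
    }

module GaloisConnection {P Q : Ord} (poP : IsPoset P) (poQ : IsPoset Q)
  (f : Carrier P → Carrier Q) (g : Carrier Q → Carrier P)
  (f⊣g : ∀ {x y} → _≤_ Q (f x) y ⇔ _≤_ P x (g y)) where
  private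
    module P = IsPartialOrder poP
    module Q = IsPartialOrder poQ
  open Equivalence

  unit : ∀ x → _≤_ P x (g (f x))
  unit x = to f⊣g Q.refl

  counit : ∀ y → _≤_ Q (f (g y)) y
  counit y = from f⊣g P.refl

  f-mono : ∀ {x x′} → _≤_ P x x′ → _≤_ Q (f x) (f x′)
  f-mono x≤x′ = from f⊣g (P.trans x≤x′ (unit _))

  g-mono : ∀ {y y′} → _≤_ Q y y′ → _≤_ P (g y) (g y′)
  g-mono y≤y′ = to f⊣g (Q.trans (counit _) y≤y′)

  f-preserves-lub : ∀ {x x′ s} → IsLUB P x x′ s → IsLUB Q (f x) (f x′) (f s)
  f-preserves-lub (xs , x′s , least) =
    f-mono xs , f-mono x′s , λ z fx≤z fx′≤z → from f⊣g (least _ (to f⊣g fx≤z) (to f⊣g fx′≤z))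

  g-preserves-glb : ∀ {y y′ s} → IsGLB Q y y′ s → IsGLB P (g y) (g y′) (g s)
  g-preserves-glb (sy , sy′ , greatest) =
    g-mono sy , g-mono sy′ , λ z z≤gy z≤gy′ → to f⊣g (greatest _ (from f⊣g z≤gy) (from f⊣g z≤gy′))

Restrict : (P : Ord) → (Carrier P → Set) → Ord
Restrict P Q = record { Carrier = Σ (Carrier P) Q ; _≤_ = λ x y → _≤_ P (proj₁ x) (proj₁ y) }

module _ {C : Set} {Q : C → Set} (Q-irrelevant : ∀ x (p q : Q x) → p ≡ q) where

  Σ-≡-irrelevant : ∀ {x y} {qx : Q x} {qy : Q y} → x ≡ y → _≡_ {A = Σ C Q} (x , qx) (y , qy)
  Σ-≡-irrelevant {x} {qx = qx} {qy} refl = cong (x ,_) (Q-irrelevant x qx qy)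

  Σ-≟-irrelevant : DecidableEquality C → DecidableEquality (Σ C Q)
  Σ-≟-irrelevant _≟_ (x , _) (y , _) with x ≟ y
  ... | yes x≡y = yes (Σ-≡-irrelevant x≡y)
  ... | no  x≢y = no (λ e → x≢y (cong proj₁ e))

-- Lattices

toLattice : (P : Ord) → IsLattice P → Lattice 0ℓ 0ℓ 0ℓ
toLattice P (_ , po , sup , inf) = record
  { _≈_ = _≡_
  ; _≤_ = _≤_ P
  ; _∨_ = λ x y → proj₁ (sup x y)
  ; _∧_ = λ x y → proj₁ (inf x y)
  ; isLattice = record
    { isPartialOrder = po
    ; supremum = λ x y → proj₂ (sup x y)
    ; infimum = λ x y → proj₂ (inf x y)
    }
  }

module MaximalSearch {C : Set} (_≟_ : DecidableEquality C) (_R_ : C → C → Set) (R? : ∀ x y → Dec (x R y))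
  (R-refl : ∀ {x} → x R x) (R-trans : ∀ {x y z} → x R y → y R z → x R z)
  (R-antisym : ∀ {x y} → x R y → y R x → x ≡ y) (t : C) where

  maximal-above : (xs : List C) → ∀ m → m ≢ t →
    Σ C λ m′ → m R m′ × m′ ≢ t × (∀ z → z ∈ xs → z ≢ t → m′ R z → z ≡ m′)
  maximal-above [] m m≢t = m , R-refl , m≢t , λ _ ()
  maximal-above (z ∷ zs) m m≢t with R? m z | z ≟ t
  ... | yes mRz | no z≢t =
    let m′ , zRm′ , m′≢t , maximal = maximal-above zs z z≢t
    in m′ , R-trans mRz zRm′ , m′≢t , λ where
         _ (here refl) _ m′Rz → R-antisym zRm′ m′Rz
         w (there w∈zs) w≢t m′Rw → maximal w w∈zs w≢t m′Rw
  ... | yes _ | yes z≡t =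
    let m′ , mRm′ , m′≢t , maximal = maximal-above zs m m≢t
    in m′ , mRm′ , m′≢t , λ where
         _ (here refl) z≢t _ → ⊥-elim (z≢t z≡t)
         w (there w∈zs) w≢t m′Rw → maximal w w∈zs w≢t m′Rw
  ... | no ¬mRz | _ =
    let m′ , mRm′ , m′≢t , maximal = maximal-above zs m m≢t
    in m′ , mRm′ , m′≢t , λ where
         _ (here refl) _ m′Rz → ⊥-elim (¬mRz (R-trans mRm′ m′Rz))
         w (there w∈zs) w≢t m′Rw → maximal w w∈zs w≢t m′Rw

module LatticeProperties (P : Ord) (lat : IsLattice P) (_≟_ : DecidableEquality (Carrier P)) where
  open Lattice (toLattice P lat) public
    using (_∨_; _∧_; x≤x∨y; y≤x∨y; ∨-least; x∧y≤x; x∧y≤y; ∧-greatest; reflexive)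
    renaming (refl to ≤-refl; trans to ≤-trans; antisym to ≤-antisym)

  lub : ∀ x y → IsLUB P x y (x ∨ y)
  lub x y = x≤x∨y x y , y≤x∨y x y , λ _ → ∨-least

  glb : ∀ x y → IsGLB P x y (x ∧ y)
  glb x y = x∧y≤x x y , x∧y≤y x y , λ _ → ∧-greatest

  _≤?_ : ∀ x y → Dec (_≤_ P x y)
  x ≤? y = map′ (λ x∧y≡x → subst (λ z → _≤_ P z y) x∧y≡x (x∧y≤y x y))
                (λ x≤y → ≤-antisym (x∧y≤x x y) (∧-greatest ≤-refl x≤y))
                ((x ∧ y) ≟ x)

  ≤-foldr-∨ : ∀ {x} x₀ {xs} → x ∈ xs → _≤_ P x (List.foldr _∨_ x₀ xs)
  ≤-foldr-∨ x₀ {y ∷ _} (here refl) = x≤x∨y y _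
  ≤-foldr-∨ x₀ {y ∷ _} (there x∈xs) = ≤-trans (≤-foldr-∨ x₀ x∈xs) (y≤x∨y y _)

  module _ (xs : List (Carrier P)) (complete : ∀ x → x ∈ xs) where

    foldr-∨-top : ∀ x₀ → IsTop P (List.foldr _∨_ x₀ xs)
    foldr-∨-top x₀ x = ≤-foldr-∨ x₀ (complete x)

    below-coatom : ∀ {t x} → IsTop P t → x ≢ t → ∃ λ c → IsCoatom P t c × _≤_ P x c
    below-coatom {t} {x} top x≢t =
      let c , x≤c , c≢t , maximal =
            MaximalSearch.maximal-above _≟_ (_≤_ P) _≤?_ ≤-refl ≤-trans ≤-antisym t xs x x≢t
      in c , ((top c , c≢t) , λ z (c≤z , c≢z) (_ , z≢t) → c≢z (sym (maximal z (complete z) z≢t c≤z))) , x≤c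

    above-atom : ∀ {b y} → IsBot P b → y ≢ b → ∃ λ a → IsAtom P b a × _≤_ P a y
    above-atom {b} {y} bot y≢b =
      let a , a≤y , a≢b , minimal =
            MaximalSearch.maximal-above _≟_ (λ u v → _≤_ P v u) (λ u v → v ≤? u)
              ≤-refl (λ u v → ≤-trans v u) (λ u v → ≤-antisym v u) b xs y y≢b
      in a , ((bot a , λ b≡a → a≢b (sym b≡a))
             , λ z (_ , b≢z) (z≤a , z≢a) → z≢a (minimal z (complete z) (λ z≡b → b≢z (sym z≡b)) z≤a))
           , a≤y

  module _ {t c : Carrier P} (top : IsTop P t) (coatom : IsCoatom P t c) where

    coatom-above : ∀ {z} → _≤_ P c z → z ≢ c → z ≡ t
    coatom-above {z} c≤z z≢c = decidable-stable (z ≟ t)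
      λ z≢t → proj₂ coatom z (c≤z , λ c≡z → z≢c (sym c≡z)) (top z , z≢t)

    comparable⇒≤coatom : ∀ {x} → x ≢ t → _≤_ P c x ⊎ _≤_ P x c → _≤_ P x c
    comparable⇒≤coatom _   (inj₂ x≤c) = x≤c
    comparable⇒≤coatom x≢t (inj₁ c≤x) = reflexive (decidable-stable (_ ≟ c) λ x≢c → x≢t (coatom-above c≤x x≢c))

    ∨-coatom : ∀ {x} → ¬ _≤_ P x c → x ∨ c ≡ t
    ∨-coatom {x} x≰c = coatom-above (y≤x∨y x c) λ x∨c≡c → x≰c (subst (_≤_ P x) x∨c≡c (x≤x∨y x c))

    coatom-meetPrime : IsDistributive P → ∀ {x x′ w} → IsGLB P x x′ w → _≤_ P w c →
                       _≤_ P x c ⊎ _≤_ P x′ c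
    coatom-meetPrime distributive {x} {x′} (w≤x , w≤x′ , greatest) w≤c with x ≤? c
    ... | yes x≤c = inj₁ x≤c
    ... | no  x≰c = inj₂ (subst (λ z → _≤_ P z c) (sym x′≡[x′∧x]∨[x′∧c])
                            (∨-least (≤-trans (greatest _ (x∧y≤y x′ x) (x∧y≤x x′ x)) w≤c) (x∧y≤y x′ c)))
      where
      x′≤x∨c : _≤_ P x′ (x ∨ c)
      x′≤x∨c = subst (_≤_ P x′) (sym (∨-coatom x≰c)) (top x′)
      x′≡[x′∧x]∨[x′∧c] : x′ ≡ (x′ ∧ x) ∨ (x′ ∧ c)
      x′≡[x′∧x]∨[x′∧c] = distributive x′ x c (x ∨ c) x′ (x′ ∧ x) (x′ ∧ c) _
        (lub x c) (≤-refl , x′≤x∨c , λ _ z≤x′ _ → z≤x′) (glb x′ x) (glb x′ c) (lub (x′ ∧ x) (x′ ∧ c))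

  module _ {b a : Carrier P} (bot : IsBot P b) (atom : IsAtom P b a) where

    atom-below : ∀ {z} → _≤_ P z a → z ≢ a → z ≡ b
    atom-below {z} z≤a z≢a = decidable-stable (z ≟ b)
      λ z≢b → proj₂ atom z (bot z , λ b≡z → z≢b (sym b≡z)) (z≤a , z≢a)

    comparable⇒atom≤ : ∀ {y} → y ≢ b → _≤_ P a y ⊎ _≤_ P y a → _≤_ P a y
    comparable⇒atom≤ _   (inj₁ a≤y) = a≤y
    comparable⇒atom≤ y≢b (inj₂ y≤a) = reflexive (sym (decidable-stable (_ ≟ a) λ y≢a → y≢b (atom-below y≤a y≢a)))

    ∧-atom : ∀ {y} → ¬ _≤_ P a y → a ∧ y ≡ b
    ∧-atom {y} a≰y = atom-below (x∧y≤x a y) λ a∧y≡a → a≰y (subst (λ z → _≤_ P z y) a∧y≡a (x∧y≤y a y))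

    atom-joinPrime : IsDistributive P → ∀ {y y′ j} → IsLUB P y y′ j → _≤_ P a j →
                     _≤_ P a y ⊎ _≤_ P a y′
    atom-joinPrime distributive {y} {y′} (y≤j , y′≤j , least) a≤j with a ≤? y
    ... | yes a≤y = inj₁ a≤y
    ... | no  a≰y = inj₂ (subst (λ z → _≤_ P z y′) (sym a≡[a∧y]∨[a∧y′])
                            (∨-least (subst (λ z → _≤_ P z y′) (sym (∧-atom a≰y)) (bot y′)) (x∧y≤y a y′)))
      where
      a≡[a∧y]∨[a∧y′] : a ≡ (a ∧ y) ∨ (a ∧ y′)
      a≡[a∧y]∨[a∧y′] = distributive a y y′ (y ∨ y′) a (a ∧ y) (a ∧ y′) _
        (lub y y′) (≤-refl , ≤-trans a≤j (least _ (x≤x∨y y y′) (y≤x∨y y y′)) , λ _ z≤a _ → z≤a)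
        (glb a y) (glb a y′) (lub (a ∧ y) (a ∧ y′))

module _ (P : Ord) (lat : IsLattice P) (_≟_ : DecidableEquality (Carrier P))
  {Q : Carrier P → Set} (Q-irrelevant : ∀ x (p q : Q x) → p ≡ q) where
  open LatticeProperties P lat _≟_

  Restrict-isLattice : ∀ {x₀} → Q x₀ → (∀ {x y} → Q x → Q y → Q (x ∨ y)) → (∀ {x y} → Q x → Q y → Q (x ∧ y)) →
                       IsLattice (Restrict P Q)
  Restrict-isLattice {x₀} qx₀ ∨-closed ∧-closed = ClosedImage.isLattice (proj₁ (proj₂ lat)) proj₁
    (record { ≤⇔ = mk⇔ (λ x≤y → x≤y) (λ x≤y → x≤y) }) (Σ-≡-irrelevant Q-irrelevant) (x₀ , qx₀)
    (λ (x , qx) (y , qy) → (x ∨ y , ∨-closed qx qy) , lub x y)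
    (λ (x , qx) (y , qy) → (x ∧ y , ∧-closed qx qy) , glb x y)

-- Finite types

Finite : Set → Set
Finite A = ∃ λ n → A ↔ Fin n

module _ {A : Set} (finite : Finite A) where
  open Inverse (proj₂ finite)

  Finite⇒≟ : DecidableEquality A
  Finite⇒≟ x y with to x Fin.≟ to y
  ... | yes tx≡ty = yes (trans (sym (strictlyInverseʳ x)) (trans (cong from tx≡ty) (strictlyInverseʳ y)))
  ... | no  tx≢ty = no (λ x≡y → tx≢ty (cong to x≡y))

  enumeration : List A
  enumeration = List.map from (allFin (proj₁ finite))

  ∈-enumeration : ∀ x → x ∈ enumeration
  ∈-enumeration x = subst (_∈ enumeration) (strictlyInverseʳ x) (∈-map⁺ from (∈-allFin (to x)))

Finite-⊎ : {A B : Set} → Finite A → Finite B → Finite (A ⊎ B)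
Finite-⊎ (m , A↔Fin) (n , B↔Fin) = m + n , ↔-trans (A↔Fin ⊎-↔ B↔Fin) (↔-sym +↔⊎)

Finite-prop : {A : Set} → Dec A → (∀ (p q : A) → p ≡ q) → Finite A
Finite-prop (yes p) irrelevant =
  1 , mk↔ₛ′ (λ _ → Fin.zero) (λ _ → p) (λ { Fin.zero → refl ; (Fin.suc ()) }) (irrelevant p)
Finite-prop (no ¬p) _ = 0 , mk↔ₛ′ (λ p → ⊥-elim (¬p p)) (λ ()) (λ ()) (λ p → ⊥-elim (¬p p))

Σ-Fin-suc-↔ : ∀ {n} (Q : Fin (suc n) → Set) → Σ (Fin (suc n)) Q ↔ (Q Fin.zero ⊎ Σ (Fin n) (Q ∘ Fin.suc))
Σ-Fin-suc-↔ Q = mk↔ₛ′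
  (λ { (Fin.zero , q) → inj₁ q ; (Fin.suc i , q) → inj₂ (i , q) })
  (λ { (inj₁ q) → Fin.zero , q ; (inj₂ (i , q)) → Fin.suc i , q })
  (λ { (inj₁ q) → refl ; (inj₂ (i , q)) → refl })
  (λ { (Fin.zero , q) → refl ; (Fin.suc i , q) → refl })

Finite-ΣFin : ∀ n (Q : Fin n → Set) → (∀ i → Dec (Q i)) → (∀ i (p q : Q i) → p ≡ q) → Finite (Σ (Fin n) Q)
Finite-ΣFin zero Q _ _ = 0 , mk↔ₛ′ (λ ()) (λ ()) (λ ()) (λ ())
Finite-ΣFin (suc n) Q Q? irrelevant =
  let k , ΣQ↔Fin = Finite-⊎ (Finite-prop (Q? Fin.zero) (irrelevant Fin.zero))
                            (Finite-ΣFin n (Q ∘ Fin.suc) (Q? ∘ Fin.suc) (irrelevant ∘ Fin.suc))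
  in k , ↔-trans (Σ-Fin-suc-↔ Q) ΣQ↔Fin

Finite-Σ : {A : Set} {Q : A → Set} → Finite A → (∀ x → Dec (Q x)) → (∀ x (p q : Q x) → p ≡ q) → Finite (Σ A Q)
Finite-Σ {Q = Q} (n , A↔Fin) Q? irrelevant =
  let k , ΣQ↔Fin = Finite-ΣFin n (Q ∘ from) (Q? ∘ from) (irrelevant ∘ from)
  in k , ↔-trans (↔-sym (Σ-cong (↔-sym A↔Fin) ↔-refl)) ΣQ↔Fin
  where open Inverse A↔Fin

-- Cut points and vertical sums

record CutPoint (P : Ord) : Set where
  field
    point      : Carrier P
    comparable : ∀ x → _≤_ P x point ⊎ _≤_ P point x
    below      : ∃ λ x → Lt P x point
    above      : ∃ λ x → Lt P point x

module _ {P Q : Ord} (P≅Q : P ≅ Q) where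
  open Inverse (proj₁ P≅Q)

  ≅-from-isOrderEmbedding : IsOrderEmbedding Q P from
  ≅-from-isOrderEmbedding = record { ≤⇔ = λ {y} {y′} → mk⇔
    (λ y≤y′ → Equivalence.from (proj₂ P≅Q (from y) (from y′))
                (subst₂ (_≤_ Q) (sym (strictlyInverseˡ y)) (sym (strictlyInverseˡ y′)) y≤y′))
    (λ fy≤fy′ → subst₂ (_≤_ Q) (strictlyInverseˡ y) (strictlyInverseˡ y′)
                  (Equivalence.to (proj₂ P≅Q (from y) (from y′)) fy≤fy′)) }

  from-injective : ∀ {y y′} → from y ≡ from y′ → y ≡ y′
  from-injective {y} {y′} fy≡fy′ = trans (sym (strictlyInverseˡ y)) (trans (cong to fy≡fy′) (strictlyInverseˡ y′))

  open IsOrderEmbedding ≅-from-isOrderEmbedding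

  ≤-from : ∀ {x y} → _≤_ Q (to x) y → _≤_ P x (from y)
  ≤-from {x} tx≤y = subst (λ z → _≤_ P z (from _)) (strictlyInverseʳ x) (mono tx≤y)

  from-≤ : ∀ {x y} → _≤_ Q y (to x) → _≤_ P (from y) x
  from-≤ {x} y≤tx = subst (_≤_ P (from _)) (strictlyInverseʳ x) (mono y≤tx)

  ≅-from-isLatticeEmbedding : IsLatticeEmbedding Q P from
  ≅-from-isLatticeEmbedding = record
    { injective = from-injective
    ; preserves-lub = λ (ys , y′s , least) → mono ys , mono y′s , λ z fy≤z fy′≤z →
        from-≤ (least _ (reflect (subst (_≤_ P _) (sym (strictlyInverseʳ z)) fy≤z))
                        (reflect (subst (_≤_ P _) (sym (strictlyInverseʳ z)) fy′≤z)))
    ; preserves-glb = λ (sy , sy′ , greatest) → mono sy , mono sy′ , λ z z≤fy z≤fy′ →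
        ≤-from (greatest _ (reflect (subst (λ w → _≤_ P w _) (sym (strictlyInverseʳ z)) z≤fy))
                           (reflect (subst (λ w → _≤_ P w _) (sym (strictlyInverseʳ z)) z≤fy′)))
    }

  CutPoint-≅ : CutPoint Q → CutPoint P
  CutPoint-≅ cut = record
    { point = from point
    ; comparable = λ x → Data.Sum.map ≤-from from-≤ (comparable (to x))
    ; below = let x , x<p = below in from x , Lt-map {Q} {P} mono from-injective x<p
    ; above = let x , p<x = above in from x , Lt-map {Q} {P} mono from-injective p<x
    }
    where open CutPoint cut

module CutPointSplit (P : Ord) (lat : IsLattice P) (_≟_ : DecidableEquality (Carrier P)) (cut : CutPoint P) where
  open LatticeProperties P lat _≟_
  open CutPoint cut renaming (point to p)

  -- Membership is True (x ≤? p) rather than x ≤ p so that it is proof-irrelevant.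
  Lower Upper : Ord
  Lower = Restrict P (λ x → True (x ≤? p))
  Upper = Restrict P (λ x → True (p ≤? x))

  _≟ᵁ_ : DecidableEquality (Carrier Upper)
  _≟ᵁ_ = Σ-≟-irrelevant (λ _ → T-irrelevant) _≟_

  p⊥ : Carrier Upper
  p⊥ = p , fromWitness ≤-refl

  CS : Set
  CS = Carrier (VSum Lower Upper _≟ᵁ_ p⊥)

  ≰p⇒p≤ : ∀ {x} → ¬ _≤_ P x p → _≤_ P p x
  ≰p⇒p≤ {x} x≰p = [ (λ x≤p → ⊥-elim (x≰p x≤p)) , (λ p≤x → p≤x) ] (comparable x)

  split-by : ∀ x → Dec (_≤_ P x p) → CS
  split-by x (yes x≤p) = inj₁ (x , fromWitness x≤p)
  split-by x (no  x≰p) = inj₂ ((x , fromWitness (≰p⇒p≤ x≰p)) , fromWitnessFalse λ e → x≰p (reflexive (cong proj₁ e)))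

  -- Going through split-by lets split-unsplit case on the decision without abstracting x ≤? p,
  -- which occurs in the type of the membership proof.
  split : Carrier P → CS
  split x = split-by x (x ≤? p)

  unsplit : CS → Carrier P
  unsplit (inj₁ (x , _)) = x
  unsplit (inj₂ ((x , _) , _)) = x

  unsplit-split : ∀ x → unsplit (split x) ≡ x
  unsplit-split x with x ≤? p
  ... | yes _ = refl
  ... | no  _ = refl

  split-unsplit : ∀ s → split (unsplit s) ≡ s
  split-unsplit (inj₁ (x , x≤p)) = by (x ≤? p)
    where
    by : ∀ d → split-by x d ≡ inj₁ (x , x≤p)
    by (yes _)   = cong inj₁ (Σ-≡-irrelevant (λ _ → T-irrelevant) refl)
    by (no  x≰p) = ⊥-elim (x≰p (toWitness x≤p))
  split-unsplit (inj₂ ((x , p≤x) , x≢p)) = by (x ≤? p)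
    where
    by : ∀ d → split-by x d ≡ inj₂ ((x , p≤x) , x≢p)
    by (yes x≤p) = ⊥-elim (toWitnessFalse x≢p (Σ-≡-irrelevant (λ _ → T-irrelevant) (≤-antisym x≤p (toWitness p≤x))))
    by (no  _)   = cong inj₂ (Σ-≡-irrelevant (λ _ → T-irrelevant) (Σ-≡-irrelevant (λ _ → T-irrelevant) refl))

  split-≤⇔ : ∀ x y → _≤_ P x y ⇔ _≤_ (VSum Lower Upper _≟ᵁ_ p⊥) (split x) (split y)
  split-≤⇔ x y with x ≤? p | y ≤? p
  ... | yes _   | yes _   = mk⇔ (λ x≤y → x≤y) (λ x≤y → x≤y)
  ... | yes x≤p | no  y≰p = mk⇔ (λ _ → tt) (λ _ → ≤-trans x≤p (≰p⇒p≤ y≰p))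
  ... | no  x≰p | yes y≤p = mk⇔ (λ x≤y → x≰p (≤-trans x≤y y≤p)) ⊥-elim
  ... | no  _   | no  _   = mk⇔ (λ x≤y → x≤y) (λ x≤y → x≤y)

  isVerticalSum : IsVerticalSum P
  isVerticalSum = Lower , Upper , _≟ᵁ_ , p⊥
    , Restrict-isLattice P lat _≟_ (λ _ → T-irrelevant) (fromWitness ≤-refl)
        (λ x≤p y≤p → fromWitness (∨-least (toWitness x≤p) (toWitness y≤p)))
        (λ x≤p _ → fromWitness (≤-trans (x∧y≤x _ _) (toWitness x≤p)))
    , Restrict-isLattice P lat _≟_ (λ _ → T-irrelevant) (fromWitness ≤-refl)
        (λ p≤x _ → fromWitness (≤-trans (toWitness p≤x) (x≤x∨y _ _)))
        (λ p≤x p≤y → fromWitness (∧-greatest (toWitness p≤x) (toWitness p≤y)))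
    , (let lo , lo≤p , lo≢p = below in (lo , fromWitness lo≤p) , (p , fromWitness ≤-refl) , lo≢p ∘ cong proj₁)
    , (let hi , p≤hi , p≢hi = above in p⊥ , (hi , fromWitness p≤hi) , p≢hi ∘ cong proj₁)
    , (λ y → toWitness (proj₂ y))
    , mk↔ₛ′ split unsplit split-unsplit unsplit-split , split-≤⇔

CutPoint⇒IsVerticalSum : ∀ P → IsLattice P → DecidableEquality (Carrier P) → CutPoint P → IsVerticalSum P
CutPoint⇒IsVerticalSum P lat _≟_ = CutPointSplit.isVerticalSum P lat _≟_

module _ {L U : Ord} (latL : IsLattice L) {_≟ᵁ_ : DecidableEquality (Carrier U)} {b : Carrier U}
  (finite : Finite (Carrier (VSum L U _≟ᵁ_ b))) where
  private
    _≟_ = Finite⇒≟ finite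

  VSum-cutPoint : NonSingleton L → NonSingleton U → CutPoint (VSum L U _≟ᵁ_ b)
  VSum-cutPoint (l₁ , l₂ , l₁≢l₂) (u₁ , u₂ , u₁≢u₂) = record
    { point = inj₁ t
    ; comparable = λ { (inj₁ l) → inj₁ (top l) ; (inj₂ _) → inj₂ tt }
    ; below = below
    ; above = above
    }
    where
    _≟ᴸ_ : DecidableEquality (Carrier L)
    l ≟ᴸ l′ = map′ inj₁-injective (cong inj₁) (inj₁ l ≟ inj₁ l′)
    open LatticeProperties L latL _≟ᴸ_
    restrictᴸ : Carrier (VSum L U _≟ᵁ_ b) → Carrier L
    restrictᴸ = [ (λ l → l) , (λ _ → l₁) ]
    t : Carrier L
    t = List.foldr _∨_ l₁ (List.map restrictᴸ (enumeration finite))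
    top : IsTop L t
    top = foldr-∨-top (List.map restrictᴸ (enumeration finite))
                      (λ l → ∈-map⁺ restrictᴸ (∈-enumeration finite (inj₁ l))) l₁
    below : ∃ λ x → Lt (VSum L U _≟ᵁ_ b) x (inj₁ t)
    below with l₁ ≟ᴸ t
    ... | no  l₁≢t = inj₁ l₁ , top l₁ , λ e → l₁≢t (inj₁-injective e)
    ... | yes l₁≡t = inj₁ l₂ , top l₂ , λ e → l₁≢l₂ (trans l₁≡t (sym (inj₁-injective e)))
    above : ∃ λ x → Lt (VSum L U _≟ᵁ_ b) (inj₁ t) x
    above with u₁ ≟ᵁ b
    ... | no  u₁≢b = inj₂ (u₁ , fromWitnessFalse u₁≢b) , tt , λ ()
    ... | yes u₁≡b = inj₂ (u₂ , fromWitnessFalse λ u₂≡b → u₁≢u₂ (trans u₁≡b (sym u₂≡b))) , tt , λ ()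

IsVerticalSum⇒CutPoint : ∀ {P} → Finite (Carrier P) → IsVerticalSum P → CutPoint P
IsVerticalSum⇒CutPoint (n , P↔Fin) (L , U , _ , _ , latL , _ , nonSingletonL , nonSingletonU , _ , P≅VS) =
  CutPoint-≅ P≅VS (VSum-cutPoint latL (n , ↔-trans (↔-sym (proj₁ P≅VS)) P↔Fin) nonSingletonL nonSingletonU)

-- The vertical 2-sum

module TwoSum {L U : Ord} (latL : IsLattice L) (latU : IsLattice U)
  (_≟ᴸ_ : DecidableEquality (Carrier L)) (_≟ᵁ_ : DecidableEquality (Carrier U))
  (enumᴸ : List (Carrier L)) (∈-enumᴸ : ∀ x → x ∈ enumᴸ)
  (enumᵁ : List (Carrier U)) (∈-enumᵁ : ∀ y → y ∈ enumᵁ)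
  {t c₁ c₂ : Carrier L} {b a₁ a₂ : Carrier U}
  (top : IsTop L t) (coatoms : ExactlyTwoCoatoms L t c₁ c₂)
  (bot : IsBot U b) (atoms : ExactlyTwoAtoms U b a₁ a₂) where

  module L = LatticeProperties L latL _≟ᴸ_
  module U = LatticeProperties U latU _≟ᵁ_

  infix 4 _≤ᴸ_ _≤ᵁ_
  _≤ᴸ_ : Carrier L → Carrier L → Set
  _≤ᴸ_ = _≤_ L
  _≤ᵁ_ : Carrier U → Carrier U → Set
  _≤ᵁ_ = _≤_ U

  V : Ord
  V = V2Sum L U _≟ᴸ_ _≟ᵁ_ t c₁ c₂ b a₁ a₂

  k : Carrier L
  k = c₁ L.∧ c₂

  m : Carrier U
  m = a₁ U.∨ a₂

  private
    coatom₁ = proj₁ coatoms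
    coatom₂ = proj₁ (proj₂ coatoms)
    atom₁ = proj₁ atoms
    atom₂ = proj₁ (proj₂ atoms)

  c₁≰c₂ : ¬ c₁ ≤ᴸ c₂
  c₁≰c₂ c₁≤c₂ = proj₂ coatom₁ c₂ (c₁≤c₂ , proj₁ (proj₂ (proj₂ coatoms))) (proj₁ coatom₂)

  c₂≰c₁ : ¬ c₂ ≤ᴸ c₁
  c₂≰c₁ c₂≤c₁ = proj₂ coatom₂ c₁ (c₂≤c₁ , λ c₂≡c₁ → proj₁ (proj₂ (proj₂ coatoms)) (sym c₂≡c₁)) (proj₁ coatom₁)

  a₁≰a₂ : ¬ a₁ ≤ᵁ a₂
  a₁≰a₂ a₁≤a₂ = proj₂ atom₂ a₁ (proj₁ atom₁) (a₁≤a₂ , proj₁ (proj₂ (proj₂ atoms)))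

  a₂≰a₁ : ¬ a₂ ≤ᵁ a₁
  a₂≰a₁ a₂≤a₁ = proj₂ atom₁ a₂ (proj₁ atom₂) (a₂≤a₁ , λ a₂≡a₁ → proj₁ (proj₂ (proj₂ atoms)) (sym a₂≡a₁))

  t≰c₁ : ¬ t ≤ᴸ c₁
  t≰c₁ t≤c₁ = proj₂ (proj₁ coatom₁) (L.≤-antisym (top c₁) t≤c₁)

  t≰c₂ : ¬ t ≤ᴸ c₂
  t≰c₂ t≤c₂ = proj₂ (proj₁ coatom₂) (L.≤-antisym (top c₂) t≤c₂)

  c₁≤z→c₂≤z→z≡t : ∀ {z} → c₁ ≤ᴸ z → c₂ ≤ᴸ z → z ≡ t
  c₁≤z→c₂≤z→z≡t c₁≤z c₂≤z = L.coatom-above top coatom₁ c₁≤z λ z≡c₁ → c₂≰c₁ (subst (c₂ ≤ᴸ_) z≡c₁ c₂≤z)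

  z≤a₁→z≤a₂→z≡b : ∀ {z} → z ≤ᵁ a₁ → z ≤ᵁ a₂ → z ≡ b
  z≤a₁→z≤a₂→z≡b z≤a₁ z≤a₂ = U.atom-below bot atom₁ z≤a₁ λ z≡a₁ → a₁≰a₂ (subst (_≤ᵁ a₂) z≡a₁ z≤a₂)

  coatom-cover : ∀ {x} → x ≢ t → x ≤ᴸ c₁ ⊎ x ≤ᴸ c₂
  coatom-cover {x} x≢t =
    let c , coatom , x≤c = L.below-coatom enumᴸ ∈-enumᴸ top x≢t
    in Data.Sum.map (λ c≡c₁ → subst (x ≤ᴸ_) c≡c₁ x≤c) (λ c≡c₂ → subst (x ≤ᴸ_) c≡c₂ x≤c)
                    (proj₂ (proj₂ (proj₂ coatoms)) c coatom)

  atom-cover : ∀ {y} → y ≢ b → a₁ ≤ᵁ y ⊎ a₂ ≤ᵁ y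
  atom-cover {y} y≢b =
    let a , atom , a≤y = U.above-atom enumᵁ ∈-enumᵁ bot y≢b
    in Data.Sum.map (λ a≡a₁ → subst (_≤ᵁ y) a≡a₁ a≤y) (λ a≡a₂ → subst (_≤ᵁ y) a≡a₂ a≤y)
                    (proj₂ (proj₂ (proj₂ atoms)) a atom)

  up : Carrier L → Carrier U
  up x with x L.≤? c₁ | x L.≤? c₂
  ... | yes _ | yes _ = b
  ... | yes _ | no  _ = a₁
  ... | no  _ | yes _ = a₂
  ... | no  _ | no  _ = m

  down : Carrier U → Carrier L
  down y with a₁ U.≤? y | a₂ U.≤? y
  ... | yes _ | yes _ = t
  ... | yes _ | no  _ = c₁
  ... | no  _ | yes _ = c₂
  ... | no  _ | no  _ = k

  up-≤ : ∀ {x y} → up x ≤ᵁ y ⇔ ((¬ x ≤ᴸ c₂ → a₁ ≤ᵁ y) × (¬ x ≤ᴸ c₁ → a₂ ≤ᵁ y))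
  up-≤ {x} {y} with x L.≤? c₁ | x L.≤? c₂
  ... | yes x≤c₁ | yes x≤c₂ = mk⇔ (λ _ → (λ x≰c₂ → ⊥-elim (x≰c₂ x≤c₂)) , (λ x≰c₁ → ⊥-elim (x≰c₁ x≤c₁))) (λ _ → bot y)
  ... | yes x≤c₁ | no  x≰c₂ = mk⇔ (λ a₁≤y → (λ _ → a₁≤y) , (λ x≰c₁ → ⊥-elim (x≰c₁ x≤c₁))) (λ (h₁ , _) → h₁ x≰c₂)
  ... | no  x≰c₁ | yes x≤c₂ = mk⇔ (λ a₂≤y → (λ x≰c₂ → ⊥-elim (x≰c₂ x≤c₂)) , (λ _ → a₂≤y)) (λ (_ , h₂) → h₂ x≰c₁)
  ... | no  x≰c₁ | no  x≰c₂ =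
    mk⇔ (λ m≤y → (λ _ → U.≤-trans (U.x≤x∨y a₁ a₂) m≤y) , (λ _ → U.≤-trans (U.y≤x∨y a₁ a₂) m≤y))
        (λ (h₁ , h₂) → U.∨-least (h₁ x≰c₂) (h₂ x≰c₁))

  ≤-up : ∀ {x y} → y ≤ᵁ up x ⇔ ((x ≤ᴸ c₁ → y ≤ᵁ a₁) × (x ≤ᴸ c₂ → y ≤ᵁ a₂) × y ≤ᵁ m)
  ≤-up {x} {y} with x L.≤? c₁ | x L.≤? c₂
  ... | yes x≤c₁ | yes x≤c₂ =
    mk⇔ (λ y≤b → (λ _ → U.≤-trans y≤b (bot a₁)) , (λ _ → U.≤-trans y≤b (bot a₂)) , U.≤-trans y≤b (bot m))
        (λ (h₁ , h₂ , _) → U.reflexive (z≤a₁→z≤a₂→z≡b (h₁ x≤c₁) (h₂ x≤c₂)))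
  ... | yes x≤c₁ | no  x≰c₂ =
    mk⇔ (λ y≤a₁ → (λ _ → y≤a₁) , (λ x≤c₂ → ⊥-elim (x≰c₂ x≤c₂)) , U.≤-trans y≤a₁ (U.x≤x∨y a₁ a₂))
        (λ (h₁ , _ , _) → h₁ x≤c₁)
  ... | no  x≰c₁ | yes x≤c₂ =
    mk⇔ (λ y≤a₂ → (λ x≤c₁ → ⊥-elim (x≰c₁ x≤c₁)) , (λ _ → y≤a₂) , U.≤-trans y≤a₂ (U.y≤x∨y a₁ a₂))
        (λ (_ , h₂ , _) → h₂ x≤c₂)
  ... | no  x≰c₁ | no  x≰c₂ =
    mk⇔ (λ y≤m → (λ x≤c₁ → ⊥-elim (x≰c₁ x≤c₁)) , (λ x≤c₂ → ⊥-elim (x≰c₂ x≤c₂)) , y≤m) (λ (_ , _ , y≤m) → y≤m)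

  ≤-down : ∀ {y z} → z ≤ᴸ down y ⇔ ((¬ a₂ ≤ᵁ y → z ≤ᴸ c₁) × (¬ a₁ ≤ᵁ y → z ≤ᴸ c₂))
  ≤-down {y} {z} with a₁ U.≤? y | a₂ U.≤? y
  ... | yes a₁≤y | yes a₂≤y = mk⇔ (λ _ → (λ a₂≰y → ⊥-elim (a₂≰y a₂≤y)) , (λ a₁≰y → ⊥-elim (a₁≰y a₁≤y))) (λ _ → top z)
  ... | yes a₁≤y | no  a₂≰y = mk⇔ (λ z≤c₁ → (λ _ → z≤c₁) , (λ a₁≰y → ⊥-elim (a₁≰y a₁≤y))) (λ (h₁ , _) → h₁ a₂≰y)
  ... | no  a₁≰y | yes a₂≤y = mk⇔ (λ z≤c₂ → (λ a₂≰y → ⊥-elim (a₂≰y a₂≤y)) , (λ _ → z≤c₂)) (λ (_ , h₂) → h₂ a₁≰y)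
  ... | no  a₁≰y | no  a₂≰y =
    mk⇔ (λ z≤k → (λ _ → L.≤-trans z≤k (L.x∧y≤x c₁ c₂)) , (λ _ → L.≤-trans z≤k (L.x∧y≤y c₁ c₂)))
        (λ (h₁ , h₂) → L.∧-greatest (h₁ a₂≰y) (h₂ a₁≰y))

  down-≤ : ∀ {y z} → down y ≤ᴸ z ⇔ ((a₁ ≤ᵁ y → c₁ ≤ᴸ z) × (a₂ ≤ᵁ y → c₂ ≤ᴸ z) × k ≤ᴸ z)
  down-≤ {y} {z} with a₁ U.≤? y | a₂ U.≤? y
  ... | yes a₁≤y | yes a₂≤y =
    mk⇔ (λ t≤z → (λ _ → L.≤-trans (top c₁) t≤z) , (λ _ → L.≤-trans (top c₂) t≤z) , L.≤-trans (top k) t≤z)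
        (λ (h₁ , h₂ , _) → L.reflexive (sym (c₁≤z→c₂≤z→z≡t (h₁ a₁≤y) (h₂ a₂≤y))))
  ... | yes a₁≤y | no  a₂≰y =
    mk⇔ (λ c₁≤z → (λ _ → c₁≤z) , (λ a₂≤y → ⊥-elim (a₂≰y a₂≤y)) , L.≤-trans (L.x∧y≤x c₁ c₂) c₁≤z)
        (λ (h₁ , _ , _) → h₁ a₁≤y)
  ... | no  a₁≰y | yes a₂≤y =
    mk⇔ (λ c₂≤z → (λ a₁≤y → ⊥-elim (a₁≰y a₁≤y)) , (λ _ → c₂≤z) , L.≤-trans (L.x∧y≤y c₁ c₂) c₂≤z)
        (λ (_ , h₂ , _) → h₂ a₂≤y)
  ... | no  a₁≰y | no  a₂≰y =
    mk⇔ (λ k≤z → (λ a₁≤y → ⊥-elim (a₁≰y a₁≤y)) , (λ a₂≤y → ⊥-elim (a₂≰y a₂≤y)) , k≤z) (λ (_ , _ , k≤z) → k≤z)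

  up⊣down : ∀ {x y} → up x ≤ᵁ y ⇔ x ≤ᴸ down y
  up⊣down {x} {y} = mk⇔
    (λ up≤y → let h₁ , h₂ = Equivalence.to up-≤ up≤y in Equivalence.from ≤-down
       ( (λ a₂≰y → decidable-stable (x L.≤? c₁) (λ x≰c₁ → a₂≰y (h₂ x≰c₁)))
       , (λ a₁≰y → decidable-stable (x L.≤? c₂) (λ x≰c₂ → a₁≰y (h₁ x≰c₂)))))
    (λ x≤down → let h₁ , h₂ = Equivalence.to ≤-down x≤down in Equivalence.from up-≤
       ( (λ x≰c₂ → decidable-stable (a₁ U.≤? y) (λ a₁≰y → x≰c₂ (h₂ a₁≰y)))
       , (λ x≰c₁ → decidable-stable (a₂ U.≤? y) (λ a₂≰y → x≰c₁ (h₁ a₂≰y)))))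

  open GaloisConnection (proj₁ (proj₂ latL)) (proj₁ (proj₂ latU)) up down up⊣down public
    renaming (f-mono to up-mono; g-mono to down-mono; f-preserves-lub to up-preserves-lub;
              g-preserves-glb to down-preserves-glb)

  a₁≤up : ∀ {x} → ¬ x ≤ᴸ c₂ → a₁ ≤ᵁ up x
  a₁≤up = proj₁ (Equivalence.to up-≤ U.≤-refl)

  a₂≤up : ∀ {x} → ¬ x ≤ᴸ c₁ → a₂ ≤ᵁ up x
  a₂≤up = proj₂ (Equivalence.to up-≤ U.≤-refl)

  up≤a₁ : ∀ {x} → x ≤ᴸ c₁ → up x ≤ᵁ a₁
  up≤a₁ = proj₁ (Equivalence.to ≤-up U.≤-refl)

  up≤a₂ : ∀ {x} → x ≤ᴸ c₂ → up x ≤ᵁ a₂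
  up≤a₂ = proj₁ (proj₂ (Equivalence.to ≤-up U.≤-refl))

  up≤m : ∀ x → up x ≤ᵁ m
  up≤m x = Equivalence.from up-≤ ((λ _ → U.x≤x∨y a₁ a₂) , (λ _ → U.y≤x∨y a₁ a₂))

  c₁≤down : ∀ {y} → a₁ ≤ᵁ y → c₁ ≤ᴸ down y
  c₁≤down = proj₁ (Equivalence.to down-≤ L.≤-refl)

  c₂≤down : ∀ {y} → a₂ ≤ᵁ y → c₂ ≤ᴸ down y
  c₂≤down = proj₁ (proj₂ (Equivalence.to down-≤ L.≤-refl))

  k≤down : ∀ y → k ≤ᴸ down y
  k≤down y = proj₂ (proj₂ (Equivalence.to down-≤ L.≤-refl))

  Removed : Carrier U → Set
  Removed y = y ≡ b ⊎ y ≡ a₁ ⊎ y ≡ a₂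

  Removed? : ∀ y → Dec (Removed y)
  Removed? y = y ≟ᵁ b ⊎-dec y ≟ᵁ a₁ ⊎-dec y ≟ᵁ a₂

  Removed-≤a₁ : ∀ {y} → Removed y → ¬ a₂ ≤ᵁ y → y ≤ᵁ a₁
  Removed-≤a₁ (inj₁ refl)        _     = bot a₁
  Removed-≤a₁ (inj₂ (inj₁ refl)) _     = U.≤-refl
  Removed-≤a₁ (inj₂ (inj₂ refl)) a₂≰a₂ = ⊥-elim (a₂≰a₂ U.≤-refl)

  Removed-≤a₂ : ∀ {y} → Removed y → ¬ a₁ ≤ᵁ y → y ≤ᵁ a₂
  Removed-≤a₂ (inj₁ refl)        _     = bot a₂
  Removed-≤a₂ (inj₂ (inj₁ refl)) a₁≰a₁ = ⊥-elim (a₁≰a₁ U.≤-refl)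
  Removed-≤a₂ (inj₂ (inj₂ refl)) _     = U.≤-refl

  Removed-≤m : ∀ {y} → Removed y → y ≤ᵁ m
  Removed-≤m (inj₁ refl)        = bot m
  Removed-≤m (inj₂ (inj₁ refl)) = U.x≤x∨y a₁ a₂
  Removed-≤m (inj₂ (inj₂ refl)) = U.y≤x∨y a₁ a₂

  Removed-¬above-atoms : ∀ {y} → Removed y → a₁ ≤ᵁ y → ¬ a₂ ≤ᵁ y
  Removed-¬above-atoms (inj₁ refl)        a₁≤b _ = proj₂ (proj₁ atom₁) (U.≤-antisym (bot a₁) a₁≤b)
  Removed-¬above-atoms (inj₂ (inj₁ refl)) _      = a₂≰a₁
  Removed-¬above-atoms (inj₂ (inj₂ refl)) a₁≤a₂ _ = a₁≰a₂ a₁≤a₂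

  up-down-Removed : ∀ {y} → Removed y → up (down y) ≡ y
  up-down-Removed {y} removed = U.≤-antisym (counit y) (Equivalence.from ≤-up
    ( (λ down≤c₁ → Removed-≤a₁ removed λ a₂≤y → c₂≰c₁ (L.≤-trans (c₂≤down a₂≤y) down≤c₁))
    , (λ down≤c₂ → Removed-≤a₂ removed λ a₁≤y → c₁≰c₂ (L.≤-trans (c₁≤down a₁≤y) down≤c₂))
    , Removed-≤m removed))

  down-Removed≢t : ∀ {y} → Removed y → down y ≢ t
  down-Removed≢t {y} removed down≡t =
    let t≤c₁-unless-a₂ , t≤c₂-unless-a₁ = Equivalence.to ≤-down (L.reflexive (sym down≡t))
    in Removed-¬above-atoms removed (decidable-stable (a₁ U.≤? y) (t≰c₂ ∘ t≤c₂-unless-a₁))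
                                    (decidable-stable (a₂ U.≤? y) (t≰c₁ ∘ t≤c₁-unless-a₂))

  ¬Removed-up-t : ¬ Removed (up t)
  ¬Removed-up-t removed = Removed-¬above-atoms removed (a₁≤up t≰c₂) (a₂≤up t≰c₁)

  Kept : Carrier U → Set
  Kept y = False (y ≟ᵁ b) × False (y ≟ᵁ a₁) × False (y ≟ᵁ a₂)

  Kept-irrelevant : ∀ y (p q : Kept y) → p ≡ q
  Kept-irrelevant _ (p₁ , p₂ , p₃) (q₁ , q₂ , q₃) =
    cong₂ _,_ (T-irrelevant p₁ q₁) (cong₂ _,_ (T-irrelevant p₂ q₂) (T-irrelevant p₃ q₃))

  ¬Removed⇒Kept : ∀ {y} → ¬ Removed y → Kept y
  ¬Removed⇒Kept ¬removed = fromWitnessFalse (¬removed ∘ inj₁) , fromWitnessFalse (¬removed ∘ inj₂ ∘ inj₁)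
                         , fromWitnessFalse (¬removed ∘ inj₂ ∘ inj₂)

  π : Carrier V → Carrier (L ×ₒ U)
  π (inj₁ (x , _)) = x , up x
  π (inj₂ (y , _)) = down y , y

  ιᴸ : Carrier L → Carrier V
  ιᴸ x with x ≟ᴸ t
  ... | yes _   = inj₂ (up t , ¬Removed⇒Kept ¬Removed-up-t)
  ... | no  x≢t = inj₁ (x , fromWitnessFalse x≢t)

  ιᵁ : Carrier U → Carrier V
  ιᵁ y with Removed? y
  ... | yes removed = inj₁ (down y , fromWitnessFalse (down-Removed≢t removed))
  ... | no  ¬removed = inj₂ (y , ¬Removed⇒Kept ¬removed)

  π-ιᴸ : ∀ x → π (ιᴸ x) ≡ (x , up x)
  π-ιᴸ x with x ≟ᴸ t
  ... | yes refl = cong (_, up t) (L.≤-antisym (top _) (unit t))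
  ... | no  _    = refl

  π-ιᵁ : ∀ y → π (ιᵁ y) ≡ (down y , y)
  π-ιᵁ y with Removed? y
  ... | yes removed = cong (down y ,_) (up-down-Removed removed)
  ... | no  _       = refl

  Bridge : Carrier L → Carrier U → Set
  Bridge x y = (x ≤ᴸ c₁ × a₁ ≤ᵁ y) ⊎ (x ≤ᴸ c₂ × a₂ ≤ᵁ y)

  Bridge⇒up≤ : ∀ {x y} → Bridge x y → up x ≤ᵁ y
  Bridge⇒up≤ (inj₁ (x≤c₁ , a₁≤y)) = Equivalence.from up-≤ ((λ _ → a₁≤y) , (λ x≰c₁ → ⊥-elim (x≰c₁ x≤c₁)))
  Bridge⇒up≤ (inj₂ (x≤c₂ , a₂≤y)) = Equivalence.from up-≤ ((λ x≰c₂ → ⊥-elim (x≰c₂ x≤c₂)) , (λ _ → a₂≤y))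

  up≤⇒Bridge : ∀ {x y} → x ≢ t → y ≢ b → up x ≤ᵁ y → Bridge x y
  up≤⇒Bridge {x} {y} x≢t y≢b up≤y with coatom-cover x≢t | a₁ U.≤? y | a₂ U.≤? y
  ... | inj₁ x≤c₁ | yes a₁≤y | _        = inj₁ (x≤c₁ , a₁≤y)
  ... | inj₁ _    | no  a₁≰y | _        = inj₂ (decidable-stable (x L.≤? c₂) (λ x≰c₂ → a₁≰y (h₁ x≰c₂)) , other-atom a₁≰y)
    where
    h₁ = proj₁ (Equivalence.to up-≤ up≤y)
    other-atom : ¬ a₁ ≤ᵁ y → a₂ ≤ᵁ y
    other-atom a₁≰y = [ (λ a₁≤y → ⊥-elim (a₁≰y a₁≤y)) , (λ a₂≤y → a₂≤y) ] (atom-cover y≢b)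
  ... | inj₂ x≤c₂ | _        | yes a₂≤y = inj₂ (x≤c₂ , a₂≤y)
  ... | inj₂ _    | _        | no  a₂≰y = inj₁ (decidable-stable (x L.≤? c₁) (λ x≰c₁ → a₂≰y (h₂ x≰c₁)) , other-atom a₂≰y)
    where
    h₂ = proj₂ (Equivalence.to up-≤ up≤y)
    other-atom : ¬ a₂ ≤ᵁ y → a₁ ≤ᵁ y
    other-atom a₂≰y = [ (λ a₁≤y → a₁≤y) , (λ a₂≤y → ⊥-elim (a₂≰y a₂≤y)) ] (atom-cover y≢b)

  Kept-≰-up : ∀ {x y} → x ≢ t → Kept y → ¬ y ≤ᵁ up x
  Kept-≰-up {x} {y} x≢t (y≢b , y≢a₁ , y≢a₂) y≤up with coatom-cover x≢t
  ... | inj₁ x≤c₁ = toWitnessFalse y≢b (U.atom-below bot atom₁ (U.≤-trans y≤up (up≤a₁ x≤c₁)) (toWitnessFalse y≢a₁))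
  ... | inj₂ x≤c₂ = toWitnessFalse y≢b (U.atom-below bot atom₂ (U.≤-trans y≤up (up≤a₂ x≤c₂)) (toWitnessFalse y≢a₂))

  π-≤⇔ : ∀ p q → _≤_ V p q ⇔ _≤_ (L ×ₒ U) (π p) (π q)
  π-≤⇔ (inj₁ _) (inj₁ _) = mk⇔ (λ x≤x′ → x≤x′ , up-mono x≤x′) proj₁
  π-≤⇔ (inj₂ _) (inj₂ _) = mk⇔ (λ y≤y′ → down-mono y≤y′ , y≤y′) proj₂
  π-≤⇔ (inj₁ (x , x≢t)) (inj₂ (y , y≢b , _)) =
    mk⇔ (λ bridge → Equivalence.to up⊣down (Bridge⇒up≤ bridge) , Bridge⇒up≤ bridge)
        (λ (_ , up≤y) → up≤⇒Bridge (toWitnessFalse x≢t) (toWitnessFalse y≢b) up≤y)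
  π-≤⇔ (inj₂ (y , kept)) (inj₁ (x , x≢t)) = mk⇔ ⊥-elim (λ (_ , y≤up) → Kept-≰-up (toWitnessFalse x≢t) kept y≤up)

  π-isOrderEmbedding : IsOrderEmbedding V (L ×ₒ U) π
  π-isOrderEmbedding = record { ≤⇔ = λ {p} {q} → π-≤⇔ p q }

  ×-poset : IsPoset (L ×ₒ U)
  ×-poset = ×-isPoset (proj₁ (proj₂ latL)) (proj₁ (proj₂ latU))

  π-injective : ∀ {p q} → π p ≡ π q → p ≡ q
  π-injective {inj₁ _} {inj₁ _} πp≡πq = cong inj₁ (Σ-≡-irrelevant (λ _ → T-irrelevant) (cong proj₁ πp≡πq))
  π-injective {inj₂ _} {inj₂ _} πp≡πq = cong inj₂ (Σ-≡-irrelevant Kept-irrelevant (cong proj₂ πp≡πq))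
  π-injective {p@(inj₁ _)} {q@(inj₂ _)} πp≡πq =
    ⊥-elim (Equivalence.from (π-≤⇔ q p) (IsPartialOrder.reflexive ×-poset (sym πp≡πq)))
  π-injective {p@(inj₂ _)} {q@(inj₁ _)} πp≡πq =
    ⊥-elim (Equivalence.from (π-≤⇔ p q) (IsPartialOrder.reflexive ×-poset πp≡πq))

  c₁≤common-upper-bound : ∀ {x y z} → y ≢ b → ¬ x ≤ᴸ c₂ → x ≤ᴸ z → down y ≤ᴸ z → c₁ ≤ᴸ z
  c₁≤common-upper-bound {x} {y} {z} y≢b x≰c₂ x≤z down≤z with atom-cover y≢b
  ... | inj₁ a₁≤y = L.≤-trans (c₁≤down a₁≤y) down≤z
  ... | inj₂ a₂≤y = subst (c₁ ≤ᴸ_) (sym z≡t) (top c₁)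
    where
    z≡t : z ≡ t
    z≡t = L.coatom-above top coatom₂ (L.≤-trans (c₂≤down a₂≤y) down≤z) λ z≡c₂ → x≰c₂ (subst (x ≤ᴸ_) z≡c₂ x≤z)

  c₂≤common-upper-bound : ∀ {x y z} → y ≢ b → ¬ x ≤ᴸ c₁ → x ≤ᴸ z → down y ≤ᴸ z → c₂ ≤ᴸ z
  c₂≤common-upper-bound {x} {y} {z} y≢b x≰c₁ x≤z down≤z with atom-cover y≢b
  ... | inj₂ a₂≤y = L.≤-trans (c₂≤down a₂≤y) down≤z
  ... | inj₁ a₁≤y = subst (c₂ ≤ᴸ_) (sym z≡t) (top c₂)
    where
    z≡t : z ≡ t
    z≡t = L.coatom-above top coatom₁ (L.≤-trans (c₁≤down a₁≤y) down≤z) λ z≡c₁ → x≰c₁ (subst (x ≤ᴸ_) z≡c₁ x≤z)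

  down-up-≤ : ∀ {x y z} → y ≢ b → x ≤ᴸ z → down y ≤ᴸ z → down (up x) ≤ᴸ z
  down-up-≤ {y = y} y≢b x≤z down≤z = Equivalence.from down-≤
    ( (λ a₁≤up → c₁≤common-upper-bound y≢b (λ x≤c₂ → a₁≰a₂ (U.≤-trans a₁≤up (up≤a₂ x≤c₂))) x≤z down≤z)
    , (λ a₂≤up → c₂≤common-upper-bound y≢b (λ x≤c₁ → a₂≰a₁ (U.≤-trans a₂≤up (up≤a₁ x≤c₁))) x≤z down≤z)
    , L.≤-trans (k≤down y) down≤z)

  common-lower-bound≤a₁ : ∀ {x y z} → x ≢ t → ¬ a₂ ≤ᵁ y → z ≤ᵁ up x → z ≤ᵁ y → z ≤ᵁ a₁
  common-lower-bound≤a₁ {x} {y} {z} x≢t a₂≰y z≤up z≤y with coatom-cover x≢t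
  ... | inj₁ x≤c₁ = U.≤-trans z≤up (up≤a₁ x≤c₁)
  ... | inj₂ x≤c₂ = subst (_≤ᵁ a₁) (sym z≡b) (bot a₁)
    where
    z≡b : z ≡ b
    z≡b = U.atom-below bot atom₂ (U.≤-trans z≤up (up≤a₂ x≤c₂)) λ z≡a₂ → a₂≰y (subst (_≤ᵁ y) z≡a₂ z≤y)

  common-lower-bound≤a₂ : ∀ {x y z} → x ≢ t → ¬ a₁ ≤ᵁ y → z ≤ᵁ up x → z ≤ᵁ y → z ≤ᵁ a₂
  common-lower-bound≤a₂ {x} {y} {z} x≢t a₁≰y z≤up z≤y with coatom-cover x≢t
  ... | inj₂ x≤c₂ = U.≤-trans z≤up (up≤a₂ x≤c₂)
  ... | inj₁ x≤c₁ = subst (_≤ᵁ a₂) (sym z≡b) (bot a₂)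
    where
    z≡b : z ≡ b
    z≡b = U.atom-below bot atom₁ (U.≤-trans z≤up (up≤a₁ x≤c₁)) λ z≡a₁ → a₁≰y (subst (_≤ᵁ y) z≡a₁ z≤y)

  ≤-up-down : ∀ {x y z} → x ≢ t → z ≤ᵁ up x → z ≤ᵁ y → z ≤ᵁ up (down y)
  ≤-up-down {x} x≢t z≤up z≤y = Equivalence.from ≤-up
    ( (λ down≤c₁ → common-lower-bound≤a₁ x≢t (λ a₂≤y → c₂≰c₁ (L.≤-trans (c₂≤down a₂≤y) down≤c₁)) z≤up z≤y)
    , (λ down≤c₂ → common-lower-bound≤a₂ x≢t (λ a₁≤y → c₁≰c₂ (L.≤-trans (c₁≤down a₁≤y) down≤c₂)) z≤up z≤y)
    , U.≤-trans z≤up (up≤m x))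

  module Distributive (distL : IsDistributive L) (distU : IsDistributive U) where

    up-preserves-glb : ∀ {x x′ w} → IsGLB L x x′ w → IsGLB U (up x) (up x′) (up w)
    up-preserves-glb meet@(w≤x , w≤x′ , _) = up-mono w≤x , up-mono w≤x′ , λ z z≤up z≤up′ →
      let h₁ , h₂ , z≤m = Equivalence.to ≤-up z≤up
          h₁′ , h₂′ , _ = Equivalence.to ≤-up z≤up′
      in Equivalence.from ≤-up
        ( (λ w≤c₁ → [ h₁ , h₁′ ] (L.coatom-meetPrime top coatom₁ distL meet w≤c₁))
        , (λ w≤c₂ → [ h₂ , h₂′ ] (L.coatom-meetPrime top coatom₂ distL meet w≤c₂))
        , z≤m)

    down-preserves-lub : ∀ {y y′ j} → IsLUB U y y′ j → IsLUB L (down y) (down y′) (down j)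
    down-preserves-lub join@(y≤j , y′≤j , _) = down-mono y≤j , down-mono y′≤j , λ z down≤z down′≤z →
      let h₁ , h₂ , k≤z = Equivalence.to down-≤ down≤z
          h₁′ , h₂′ , _ = Equivalence.to down-≤ down′≤z
      in Equivalence.from down-≤
        ( (λ a₁≤j → [ h₁ , h₁′ ] (U.atom-joinPrime bot atom₁ distU join a₁≤j))
        , (λ a₂≤j → [ h₂ , h₂′ ] (U.atom-joinPrime bot atom₂ distU join a₂≤j))
        , k≤z)

    lub-with-down : ∀ {x y} → y ≢ b → IsLUB L x (down y) (down (up x U.∨ y))
    lub-with-down {x} {y} y≢b =
      let up≤ , down≤ , least = down-preserves-lub (U.lub (up x) y)
      in L.≤-trans (unit x) up≤ , down≤ , λ z x≤z down≤z → least z (down-up-≤ y≢b x≤z down≤z) down≤z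

    glb-with-up : ∀ {x y} → x ≢ t → IsGLB U (up x) y (up (x L.∧ down y))
    glb-with-up {x} {y} x≢t =
      let ≤up , ≤up-down , greatest = up-preserves-glb (L.glb x (down y))
      in ≤up , U.≤-trans ≤up-down (counit y) , λ z z≤up z≤y → greatest z z≤up (≤-up-down x≢t z≤up z≤y)

    ∨-closed : ∀ p q → ∃ λ r → IsLUB (L ×ₒ U) (π p) (π q) (π r)
    ∨-closed (inj₁ (x , _)) (inj₁ (x′ , _)) = ιᴸ (x L.∨ x′) ,
      subst (IsLUB (L ×ₒ U) _ _) (sym (π-ιᴸ _)) (×-IsLUB {L} {U} (L.lub x x′) (up-preserves-lub (L.lub x x′)))
    ∨-closed (inj₂ (y , _)) (inj₂ (y′ , _)) = ιᵁ (y U.∨ y′) ,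
      subst (IsLUB (L ×ₒ U) _ _) (sym (π-ιᵁ _)) (×-IsLUB {L} {U} (down-preserves-lub (U.lub y y′)) (U.lub y y′))
    ∨-closed (inj₁ (x , _)) (inj₂ (y , y≢b , _)) = ιᵁ (up x U.∨ y) ,
      subst (IsLUB (L ×ₒ U) _ _) (sym (π-ιᵁ _)) (×-IsLUB {L} {U} (lub-with-down (toWitnessFalse y≢b)) (U.lub (up x) y))
    ∨-closed p@(inj₂ _) q@(inj₁ _) = let r , q∨p = ∨-closed q p in r , IsLUB-comm {L ×ₒ U} q∨p

    ∧-closed : ∀ p q → ∃ λ r → IsGLB (L ×ₒ U) (π p) (π q) (π r)
    ∧-closed (inj₁ (x , _)) (inj₁ (x′ , _)) = ιᴸ (x L.∧ x′) ,
      subst (IsGLB (L ×ₒ U) _ _) (sym (π-ιᴸ _)) (×-IsGLB {L} {U} (L.glb x x′) (up-preserves-glb (L.glb x x′)))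
    ∧-closed (inj₂ (y , _)) (inj₂ (y′ , _)) = ιᵁ (y U.∧ y′) ,
      subst (IsGLB (L ×ₒ U) _ _) (sym (π-ιᵁ _)) (×-IsGLB {L} {U} (down-preserves-glb (U.glb y y′)) (U.glb y y′))
    ∧-closed (inj₁ (x , x≢t)) (inj₂ (y , _)) = ιᴸ (x L.∧ down y) ,
      subst (IsGLB (L ×ₒ U) _ _) (sym (π-ιᴸ _)) (×-IsGLB {L} {U} (L.glb x (down y)) (glb-with-up (toWitnessFalse x≢t)))
    ∧-closed p@(inj₂ _) q@(inj₁ _) = let r , q∧p = ∧-closed q p in r , IsGLB-comm {L ×ₒ U} q∧p

    private
      module Image = ClosedImage ×-poset π π-isOrderEmbedding π-injective (ιᴸ t) ∨-closed ∧-closed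

    isLattice : IsLattice V
    isLattice = Image.isLattice

    isDistributive : IsDistributive V
    isDistributive = IsDistributive-embedding Image.isLatticeEmbedding
      (×-distributive (proj₁ (proj₂ latL)) (proj₁ (proj₂ latU)) distL distU)

  ≤⇔π≤ : ∀ {w w′} p q → π p ≡ w → π q ≡ w′ → _≤_ V p q ⇔ _≤_ (L ×ₒ U) w w′
  ≤⇔π≤ p q refl refl = π-≤⇔ p q

  ιᴸ-isOrderEmbedding : IsOrderEmbedding L V ιᴸ
  ιᴸ-isOrderEmbedding = record { ≤⇔ = λ {x} {x′} → mk⇔
    (λ x≤x′ → Equivalence.from (≤⇔π≤ (ιᴸ x) (ιᴸ x′) (π-ιᴸ x) (π-ιᴸ x′)) (x≤x′ , up-mono x≤x′))
    (λ ex≤ex′ → proj₁ (Equivalence.to (≤⇔π≤ (ιᴸ x) (ιᴸ x′) (π-ιᴸ x) (π-ιᴸ x′)) ex≤ex′)) }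

  ιᵁ-isOrderEmbedding : IsOrderEmbedding U V ιᵁ
  ιᵁ-isOrderEmbedding = record { ≤⇔ = λ {y} {y′} → mk⇔
    (λ y≤y′ → Equivalence.from (≤⇔π≤ (ιᵁ y) (ιᵁ y′) (π-ιᵁ y) (π-ιᵁ y′)) (down-mono y≤y′ , y≤y′))
    (λ ey≤ey′ → proj₂ (Equivalence.to (≤⇔π≤ (ιᵁ y) (ιᵁ y′) (π-ιᵁ y) (π-ιᵁ y′)) ey≤ey′)) }

  ιᴸ-injective : ∀ {x x′} → ιᴸ x ≡ ιᴸ x′ → x ≡ x′
  ιᴸ-injective {x} {x′} ex≡ex′ =
    trans (sym (cong proj₁ (π-ιᴸ x))) (trans (cong (proj₁ ∘ π) ex≡ex′) (cong proj₁ (π-ιᴸ x′)))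

  ιᵁ-injective : ∀ {y y′} → ιᵁ y ≡ ιᵁ y′ → y ≡ y′
  ιᵁ-injective {y} {y′} ey≡ey′ =
    trans (sym (cong proj₂ (π-ιᵁ y))) (trans (cong (proj₂ ∘ π) ey≡ey′) (cong proj₂ (π-ιᵁ y′)))

  inj₂≤ιᴸ⇒≡t : ∀ {v x} → _≤_ V (inj₂ v) (ιᴸ x) → x ≡ t
  inj₂≤ιᴸ⇒≡t {x = x} v≤ex with x ≟ᴸ t
  ... | yes x≡t = x≡t

  ιᵁ≤inj₁⇒Removed : ∀ {y v} → _≤_ V (ιᵁ y) (inj₁ v) → Removed y
  ιᵁ≤inj₁⇒Removed {y} ey≤v with Removed? y
  ... | yes removed = removed

  Removed-joinPrime₁ : ∀ {y y′ s} → Removed y → Removed y′ → IsLUB U y y′ s → a₁ ≤ᵁ s → a₁ ≤ᵁ y ⊎ a₁ ≤ᵁ y′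
  Removed-joinPrime₁ {y} {y′} removed removed′ (_ , _ , least) a₁≤s with a₁ U.≤? y | a₁ U.≤? y′
  ... | yes a₁≤y | _         = inj₁ a₁≤y
  ... | no  _    | yes a₁≤y′ = inj₂ a₁≤y′
  ... | no  a₁≰y | no  a₁≰y′ =
    ⊥-elim (a₁≰a₂ (U.≤-trans a₁≤s (least a₂ (Removed-≤a₂ removed a₁≰y) (Removed-≤a₂ removed′ a₁≰y′))))

  Removed-joinPrime₂ : ∀ {y y′ s} → Removed y → Removed y′ → IsLUB U y y′ s → a₂ ≤ᵁ s → a₂ ≤ᵁ y ⊎ a₂ ≤ᵁ y′
  Removed-joinPrime₂ {y} {y′} removed removed′ (_ , _ , least) a₂≤s with a₂ U.≤? y | a₂ U.≤? y′
  ... | yes a₂≤y | _         = inj₁ a₂≤y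
  ... | no  _    | yes a₂≤y′ = inj₂ a₂≤y′
  ... | no  a₂≰y | no  a₂≰y′ =
    ⊥-elim (a₂≰a₁ (U.≤-trans a₂≤s (least a₁ (Removed-≤a₁ removed a₂≰y) (Removed-≤a₁ removed′ a₂≰y′))))

  ιᴸ-isLatticeEmbedding : IsLatticeEmbedding L V ιᴸ
  ιᴸ-isLatticeEmbedding = record
    { injective = ιᴸ-injective
    ; preserves-lub = λ {x} {x′} {s} join →
        IsOrderEmbedding-reflects-lub π-isOrderEmbedding {ιᴸ x} {ιᴸ x′} {ιᴸ s} (lub× join)
    ; preserves-glb = λ {x} {x′} {s} (sx , sx′ , greatest) → mono sx , mono sx′ , λ w w≤ex w≤ex′ →
        let w₁≤x , w₂≤up = Equivalence.to (≤⇔π≤ w (ιᴸ x) refl (π-ιᴸ x)) w≤ex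
            w₁≤x′ , _    = Equivalence.to (≤⇔π≤ w (ιᴸ x′) refl (π-ιᴸ x′)) w≤ex′
            w₁≤s = greatest _ w₁≤x w₁≤x′
        in Equivalence.from (≤⇔π≤ w (ιᴸ s) refl (π-ιᴸ s)) (w₁≤s , second w w≤ex w≤ex′ w₁≤s w₂≤up greatest)
    }
    where
    open IsOrderEmbedding ιᴸ-isOrderEmbedding
    lub× : ∀ {x x′ s} → IsLUB L x x′ s → IsLUB (L ×ₒ U) (π (ιᴸ x)) (π (ιᴸ x′)) (π (ιᴸ s))
    lub× {x} {x′} {s} join rewrite π-ιᴸ x | π-ιᴸ x′ | π-ιᴸ s = ×-IsLUB {L} {U} join (up-preserves-lub join)
    second : ∀ {x x′ s} w → _≤_ V w (ιᴸ x) → _≤_ V w (ιᴸ x′) → proj₁ (π w) ≤ᴸ s → proj₂ (π w) ≤ᵁ up x →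
             (∀ z → z ≤ᴸ x → z ≤ᴸ x′ → z ≤ᴸ s) → proj₂ (π w) ≤ᵁ up s
    second (inj₁ _) _ _ w₁≤s _ _ = up-mono w₁≤s
    second {x} {x′} {s} (inj₂ _) w≤ex w≤ex′ _ w₂≤up greatest =
      subst (λ z → _ ≤ᵁ up z) (trans x≡t (sym s≡t)) w₂≤up
      where
      x≡t = inj₂≤ιᴸ⇒≡t w≤ex
      s≡t = L.≤-antisym (top s) (greatest t (L.reflexive (sym x≡t)) (L.reflexive (sym (inj₂≤ιᴸ⇒≡t w≤ex′))))

  ιᵁ-isLatticeEmbedding : IsLatticeEmbedding U V ιᵁ
  ιᵁ-isLatticeEmbedding = record
    { injective = ιᵁ-injective
    ; preserves-lub = λ {y} {y′} {s} join@(ys , y′s , least) → mono ys , mono y′s , λ w ey≤w ey′≤w →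
        let down≤w₁ , y≤w₂ = Equivalence.to (≤⇔π≤ (ιᵁ y) w (π-ιᵁ y) refl) ey≤w
            down′≤w₁ , y′≤w₂ = Equivalence.to (≤⇔π≤ (ιᵁ y′) w (π-ιᵁ y′) refl) ey′≤w
            s≤w₂ = least _ y≤w₂ y′≤w₂
        in Equivalence.from (≤⇔π≤ (ιᵁ s) w (π-ιᵁ s) refl) (first w ey≤w ey′≤w join down≤w₁ down′≤w₁ s≤w₂ , s≤w₂)
    ; preserves-glb = λ {y} {y′} {s} meet →
        IsOrderEmbedding-reflects-glb π-isOrderEmbedding {ιᵁ y} {ιᵁ y′} {ιᵁ s} (glb× meet)
    }
    where
    open IsOrderEmbedding ιᵁ-isOrderEmbedding
    glb× : ∀ {y y′ s} → IsGLB U y y′ s → IsGLB (L ×ₒ U) (π (ιᵁ y)) (π (ιᵁ y′)) (π (ιᵁ s))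
    glb× {y} {y′} {s} meet rewrite π-ιᵁ y | π-ιᵁ y′ | π-ιᵁ s = ×-IsGLB {L} {U} (down-preserves-glb meet) meet
    first : ∀ {y y′ s} w → _≤_ V (ιᵁ y) w → _≤_ V (ιᵁ y′) w → IsLUB U y y′ s →
            down y ≤ᴸ proj₁ (π w) → down y′ ≤ᴸ proj₁ (π w) → s ≤ᵁ proj₂ (π w) → down s ≤ᴸ proj₁ (π w)
    first (inj₂ _) _ _ _ _ _ s≤w₂ = down-mono s≤w₂
    first {y} {y′} (inj₁ _) ey≤w ey′≤w join down≤w₁ down′≤w₁ _ = Equivalence.from down-≤
      ( (λ a₁≤s → [ (λ a₁≤y → L.≤-trans (c₁≤down a₁≤y) down≤w₁) , (λ a₁≤y′ → L.≤-trans (c₁≤down a₁≤y′) down′≤w₁) ]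
                    (Removed-joinPrime₁ removed removed′ join a₁≤s))
      , (λ a₂≤s → [ (λ a₂≤y → L.≤-trans (c₂≤down a₂≤y) down≤w₁) , (λ a₂≤y′ → L.≤-trans (c₂≤down a₂≤y′) down′≤w₁) ]
                    (Removed-joinPrime₂ removed removed′ join a₂≤s))
      , L.≤-trans (k≤down y) down≤w₁)
      where
      removed = ιᵁ≤inj₁⇒Removed ey≤w
      removed′ = ιᵁ≤inj₁⇒Removed ey′≤w

  CutPoint-L⇒V : CutPoint L → CutPoint V
  CutPoint-L⇒V cut = record
    { point = ιᴸ x
    ; comparable = λ w → Data.Sum.map (Equivalence.from (≤⇔π≤ w (ιᴸ x) refl (π-ιᴸ x)))
                                      (Equivalence.from (≤⇔π≤ (ιᴸ x) w (π-ιᴸ x) refl)) (π-comparable w)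
    ; below = let lo , lo<x = below in ιᴸ lo , Lt-map {L} {V} mono ιᴸ-injective lo<x
    ; above = let hi , x<hi = above in ιᴸ hi , Lt-map {L} {V} mono ιᴸ-injective x<hi
    }
    where
    open CutPoint cut renaming (point to x)
    open IsOrderEmbedding ιᴸ-isOrderEmbedding
    x≢t : x ≢ t
    x≢t x≡t = let hi , x≤hi , x≢hi = above in x≢hi (L.≤-antisym x≤hi (subst (hi ≤ᴸ_) (sym x≡t) (top hi)))
    x≤c₁ = L.comparable⇒≤coatom top coatom₁ x≢t (comparable c₁)
    x≤c₂ = L.comparable⇒≤coatom top coatom₂ x≢t (comparable c₂)
    π-comparable : ∀ w → _≤_ (L ×ₒ U) (π w) (x , up x) ⊎ _≤_ (L ×ₒ U) (x , up x) (π w)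
    π-comparable (inj₁ (z , _)) = Data.Sum.map (λ z≤x → z≤x , up-mono z≤x) (λ x≤z → x≤z , up-mono x≤z) (comparable z)
    π-comparable (inj₂ _) = inj₂ ( Equivalence.from ≤-down ((λ _ → x≤c₁) , (λ _ → x≤c₂))
                                 , Equivalence.from up-≤ ((λ x≰c₂ → ⊥-elim (x≰c₂ x≤c₂)) , (λ x≰c₁ → ⊥-elim (x≰c₁ x≤c₁))))

  CutPoint-U⇒V : CutPoint U → CutPoint V
  CutPoint-U⇒V cut = record
    { point = ιᵁ y
    ; comparable = λ w → Data.Sum.map (Equivalence.from (≤⇔π≤ w (ιᵁ y) refl (π-ιᵁ y)))
                                      (Equivalence.from (≤⇔π≤ (ιᵁ y) w (π-ιᵁ y) refl)) (π-comparable w)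
    ; below = let lo , lo<y = below in ιᵁ lo , Lt-map {U} {V} mono ιᵁ-injective lo<y
    ; above = let hi , y<hi = above in ιᵁ hi , Lt-map {U} {V} mono ιᵁ-injective y<hi
    }
    where
    open CutPoint cut renaming (point to y)
    open IsOrderEmbedding ιᵁ-isOrderEmbedding
    y≢b : y ≢ b
    y≢b y≡b = let lo , lo≤y , lo≢y = below in lo≢y (U.≤-antisym lo≤y (subst (_≤ᵁ lo) (sym y≡b) (bot lo)))
    a₁≤y = U.comparable⇒atom≤ bot atom₁ y≢b (comparable a₁)
    a₂≤y = U.comparable⇒atom≤ bot atom₂ y≢b (comparable a₂)
    π-comparable : ∀ w → _≤_ (L ×ₒ U) (π w) (down y , y) ⊎ _≤_ (L ×ₒ U) (down y , y) (π w)
    π-comparable (inj₂ (u , _)) = Data.Sum.map (λ u≤y → down-mono u≤y , u≤y) (λ y≤u → down-mono y≤u , y≤u) (comparable u)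
    π-comparable (inj₁ _) = inj₁ ( Equivalence.from ≤-down ((λ a₂≰y → ⊥-elim (a₂≰y a₂≤y)) , (λ a₁≰y → ⊥-elim (a₁≰y a₁≤y)))
                                 , Equivalence.from up-≤ ((λ _ → a₁≤y) , (λ _ → a₂≤y)))

  CutPoint-V⇒L⊎U : CutPoint V → CutPoint L ⊎ CutPoint U
  CutPoint-V⇒L⊎U cut with CutPoint.point cut | CutPoint.comparable cut | CutPoint.below cut | CutPoint.above cut
  ... | inj₁ (x , x≢t) | comparable | below | _ = inj₁ (record
    { point = x
    ; comparable = λ z → Data.Sum.map (proj₁ ∘ Equivalence.to (≤⇔π≤ (ιᴸ z) (inj₁ (x , x≢t)) (π-ιᴸ z) refl))
                                      (proj₁ ∘ Equivalence.to (≤⇔π≤ (inj₁ (x , x≢t)) (ιᴸ z) refl (π-ιᴸ z)))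
                                      (comparable (ιᴸ z))
    ; below = below-x below
    ; above = t , top x , toWitnessFalse x≢t
    })
    where
    below-x : (∃ λ w → Lt V w (inj₁ (x , x≢t))) → ∃ λ z → Lt L z x
    below-x (inj₁ (z , _) , z≤x , w≢p) = z , z≤x , λ z≡x → w≢p (cong inj₁ (Σ-≡-irrelevant (λ _ → T-irrelevant) z≡x))
  ... | inj₂ (y , kept) | comparable | _ | above = inj₂ (record
    { point = y
    ; comparable = λ u → Data.Sum.map (proj₂ ∘ Equivalence.to (≤⇔π≤ (ιᵁ u) (inj₂ (y , kept)) (π-ιᵁ u) refl))
                                      (proj₂ ∘ Equivalence.to (≤⇔π≤ (inj₂ (y , kept)) (ιᵁ u) refl (π-ιᵁ u)))
                                      (comparable (ιᵁ u))
    ; below = b , bot y , λ b≡y → toWitnessFalse (proj₁ kept) (sym b≡y)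
    ; above = above-y above
    })
    where
    above-y : (∃ λ w → Lt V (inj₂ (y , kept)) w) → ∃ λ u → Lt U y u
    above-y (inj₂ (u , _) , y≤u , p≢w) = u , y≤u , λ y≡u → p≢w (cong inj₂ (Σ-≡-irrelevant Kept-irrelevant y≡u))

  V-finite : Finite (Carrier L) → Finite (Carrier U) → Finite (Carrier V)
  V-finite finL finU = Finite-⊎ (Finite-Σ finL (λ _ → T? _) (λ _ → T-irrelevant))
                                (Finite-Σ finU (λ _ → T? _ ×-dec T? _ ×-dec T? _) Kept-irrelevant)

module _ {L U : Ord} (_≟ᴸ_ : DecidableEquality (Carrier L)) (_≟ᵁ_ : DecidableEquality (Carrier U))
  {t c₁ c₂ : Carrier L} {b a₁ a₂ : Carrier U} where

  V2Sum-preserves-FinDistVi : FinDistVi L → FinDistVi U →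
    IsTop L t → ExactlyTwoCoatoms L t c₁ c₂ → IsBot U b → ExactlyTwoAtoms U b a₁ a₂ →
    FinDistVi (V2Sum L U _≟ᴸ_ _≟ᵁ_ t c₁ c₂ b a₁ a₂)
  V2Sum-preserves-FinDistVi (finL , distL , latL , ¬vsL) (finU , distU , latU , ¬vsU) top coatoms bot atoms =
    V-finite finL finU , isDistributive , isLattice , ¬vsV
    where
    open TwoSum latL latU _≟ᴸ_ _≟ᵁ_ (enumeration finL) (∈-enumeration finL) (enumeration finU) (∈-enumeration finU)
                top coatoms bot atoms
    open Distributive distL distU
    ¬vsV : ¬ IsVerticalSum V
    ¬vsV vs = [ ¬vsL ∘ CutPoint⇒IsVerticalSum L latL _≟ᴸ_ , ¬vsU ∘ CutPoint⇒IsVerticalSum U latU _≟ᵁ_ ]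
                (CutPoint-V⇒L⊎U (IsVerticalSum⇒CutPoint (V-finite finL finU) vs))

  V2Sum-reflects-FinDistVi : ∀ {S} → IsFinite L → IsLattice L → IsFinite U → IsLattice U →
    IsTop L t → ExactlyTwoCoatoms L t c₁ c₂ → IsBot U b → ExactlyTwoAtoms U b a₁ a₂ →
    S ≅ V2Sum L U _≟ᴸ_ _≟ᵁ_ t c₁ c₂ b a₁ a₂ → FinDistVi S → FinDistVi L × FinDistVi U
  V2Sum-reflects-FinDistVi {S} finL latL finU latU top coatoms bot atoms S≅V (finS , distS , latS , ¬vsS) =
    (finL , IsDistributive-embedding ιᴸ-isLatticeEmbedding distV , latL ,
            ¬vsS ∘ cut⇒S-IsVerticalSum ∘ CutPoint-L⇒V ∘ IsVerticalSum⇒CutPoint finL) ,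
    (finU , IsDistributive-embedding ιᵁ-isLatticeEmbedding distV , latU ,
            ¬vsS ∘ cut⇒S-IsVerticalSum ∘ CutPoint-U⇒V ∘ IsVerticalSum⇒CutPoint finU)
    where
    open TwoSum latL latU _≟ᴸ_ _≟ᵁ_ (enumeration finL) (∈-enumeration finL) (enumeration finU) (∈-enumeration finU)
                top coatoms bot atoms
    distV : IsDistributive V
    distV = IsDistributive-embedding (≅-from-isLatticeEmbedding S≅V) distS
    cut⇒S-IsVerticalSum : CutPoint V → IsVerticalSum S
    cut⇒S-IsVerticalSum = CutPoint⇒IsVerticalSum S latS (Finite⇒≟ finS) ∘ CutPoint-≅ S≅V

lemma6 :
    -- (C1) closure under vertical 2-sums
    (∀ (L U : Ord) (eqL : DecidableEquality (Carrier L)) (eqU : DecidableEquality (Carrier U))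
       (t c₁ c₂ : Carrier L) (b a₁ a₂ : Carrier U) →
       FinDistVi L → FinDistVi U →
       LengthAtLeast3 L → LengthAtLeast3 U →
       IsTop L t → ExactlyTwoCoatoms L t c₁ c₂ →
       IsBot U b → ExactlyTwoAtoms U b a₁ a₂ →
       FinDistVi (V2Sum L U eqL eqU t c₁ c₂ b a₁ a₂))
    ×
    -- (C2) closure under taking 2-summands
    (∀ (S L U : Ord) (eqL : DecidableEquality (Carrier L)) (eqU : DecidableEquality (Carrier U))
       (t c₁ c₂ : Carrier L) (b a₁ a₂ : Carrier U) →
       IsFinite L → IsLattice L → IsFinite U → IsLattice U →
       LengthAtLeast3 L → LengthAtLeast3 U →
       IsTop L t → ExactlyTwoCoatoms L t c₁ c₂ →
       IsBot U b → ExactlyTwoAtoms U b a₁ a₂ →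
       S ≅ V2Sum L U eqL eqU t c₁ c₂ b a₁ a₂ →
       FinDistVi S →
       FinDistVi L × FinDistVi U)
lemma6 =
  (λ L U eqL eqU t c₁ c₂ b a₁ a₂ fdvL fdvU _ _ top coatoms bot atoms →
     V2Sum-preserves-FinDistVi eqL eqU fdvL fdvU top coatoms bot atoms) ,
  (λ S L U eqL eqU t c₁ c₂ b a₁ a₂ finL latL finU latU _ _ top coatoms bot atoms S≅V fdvS →
     V2Sum-reflects-FinDistVi eqL eqU finL latL finU latU top coatoms bot atoms S≅V fdvS)
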